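{- Let $K\ge1$ be an integer with $K\equiv 2\pmod 4$, and let $p_1^{a_1}p_2^{a_2}\cdots p_r^{a_r}$ be the prime factorization of $K^2+4$ with $p_1=2$. If $m>1$ is an integer with $\pi_K(m)=m$, then either $m=2^{j_1+1}$ or $m=2^{j_1+2}p_2^{j_2}\cdots p_r^{j_r}$ for some integers $j_1,\dots,j_r\ge 0$.
   Context: The $K$-Fibonacci sequence is $F_{K,0}=0$, $F_{K,1}=1$, $F_{K,n}=K F_{K,n-1}+F_{K,n-2}$; for an integer $m>1$, $\pi_K(m)$ is the length of its shortest period modulo $m$. -}

module Defs where

open import Data.Nat using (ℕ; zero; suc; _+_; _*_; _^_; _≤_; _<_; NonZero)
open import Data.Nat.DivMod using (_%_)
open import Data.Nat.Primality using (Prime)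
open import Data.Product using (_×_; _,_; proj₁; proj₂)
open import Data.List using (List; []; _∷_; map; length; zipWith)
open import Data.Nat.ListAction using (product)
open import Data.List.Relation.Unary.All using (All)
open import Data.List.Relation.Unary.AllPairs using (AllPairs)
open import Relation.Binary.PropositionalEquality using (_≡_; _≢_)

kFib : ℕ → ℕ → ℕ
kFib K zero = 0
kFib K (suc zero) = 1
kFib K (suc (suc n)) = K * kFib K (suc n) + kFib K n

IsPeriod : ℕ → (m : ℕ) → .{{NonZero m}} → ℕ → Set
IsPeriod K m n = (1 ≤ n) × (∀ i → kFib K (i + n) % m ≡ kFib K i % m)

PisanoIs : ℕ → (m : ℕ) → .{{NonZero m}} → ℕ → Set
PisanoIs K m p = IsPeriod K m p × (∀ q → IsPeriod K m q → p ≤ q)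

factorValue : List (ℕ × ℕ) → ℕ
factorValue fs = product (map (λ pa → proj₁ pa ^ proj₂ pa) fs)

IsPrimeFactorization : ℕ → List (ℕ × ℕ) → Set
IsPrimeFactorization N fs =
  All (λ pa → Prime (proj₁ pa) × (1 ≤ proj₂ pa)) fs
  × AllPairs (λ x y → proj₁ x ≢ proj₁ y) fs
  × factorValue fs ≡ N

primePow : List ℕ → List ℕ → ℕ
primePow ps js = product (zipWith _^_ ps js)

{-# OPTIONS --safe #-}
-- Write T for the class of x in R = ℤ[x]/(x² - K x - 1). Then Tⁿ = F₍ₙ₋₁₎ + Fₙ T, so the
-- periods of (Fₙ mod M) are the n ≥ 1 with Tⁿ ≡ 1 (mod M); they are closed under sums,
-- differences and gcds, and if n is a period modulo M and p ∣ M then n p is a period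
-- modulo M p. With D = K² + 4 and U = 2T - K we have U² = D. For an odd prime q ∣ D, U is
-- nilpotent modulo q and (2T)ⁿ ≡ Kⁿ⁻¹ (K + n U), which makes 4q a period and 4 a divisor of
-- every period. For an odd prime p ∤ D, Frobenius gives (2T)ᵖ ≡ K + D^((p-1)/2) U with
-- D^((p-1)/2) ≡ ±1, so p - 1 or 2(p + 1) is a period.
--
-- Now let m be its own shortest period. If some odd prime factor of m does not divide D,
-- take the largest one, p, and N = m / p. For each prime power rᵉ⁺¹ dividing m, some N c
-- with c prime to p is a period modulo rᵉ⁺¹ (c = 2ᵉ⁺¹ for r = 2 since K is even, c = 4 rᵉ⁺¹
-- for r ∣ D, and c ∈ {r - 1, 2 (r + 1)} otherwise, which is prime to p because r ≤ p), and
-- so is m = N p; hence so is N, and by the Chinese remainder theorem N < m is a period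
-- modulo m. So every odd prime factor of m divides D, and if there is one, 4 divides m.

module Submission where

open import Level using (0ℓ)
open import Function.Base using (_$_; _∘_; id; flip)
open import Data.Empty using (⊥)
open import Data.Product.Base using (∃-syntax; _×_; _,_; proj₁; proj₂)
open import Data.Sum.Base as Sum using (_⊎_; inj₁; inj₂; [_,_]′)
open import Data.List.Base using (List; []; _∷_)
open import Data.Nat.Base using (ℕ; zero; suc; NonZero)
open import Data.Nat.ListAction using (product)
open import Data.Nat.Induction using (<-wellFounded)
open import Data.Nat.Primality
  using (Prime; prime; euclidsLemma; prime⇒irreducible; prime⇒nonZero; prime[2]; ¬prime[0]; ¬prime[1])
open import Data.Nat.Coprimality using (Coprime; coprime-divisor)
open import Data.Integer.Base using (ℤ; +_; 0ℤ; 1ℤ; -1ℤ; ∣_∣)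
import Data.Integer.Properties as ℤ
open import Data.Integer.Tactic.RingSolver using (solve)
open import Induction.WellFounded using (Acc; acc)
open import Relation.Nullary using (¬_; contradiction; yes; no)
open import Relation.Nullary.Decidable using (toWitnessFalse)
open import Relation.Binary.Core using (Rel)
open import Relation.Binary.Bundles using (Setoid)
open import Relation.Binary.Structures using (IsEquivalence)
open import Relation.Binary.PropositionalEquality
  using (_≡_; _≢_; refl; sym; trans; cong; cong₂; subst; subst₂; isEquivalence; module ≡-Reasoning)
import Relation.Binary.Reasoning.Setoid as SetoidReasoning
open import Algebra.Core using (Op₂)
open import Algebra.Definitions using (Congruent₂)
open import Algebra.Structures using (IsCommutativeSemiring)
open import Algebra.Bundles using (CommutativeSemiring)
import Algebra.Structures.Biased

open import Defs using (kFib; IsPeriod; PisanoIs; IsPrimeFactorization; factorValue; primePow)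

-- Elementary number theory

module _ where
  open import Data.Nat.Base
  open import Data.Nat.Properties
  open import Data.Nat.Divisibility
  open import Data.Nat.Coprimality using (coprime⇒gcd≡1; 1-coprimeTo)
  open import Data.Nat.GCD using (gcd; gcd-GCD; module Bézout)
  open import Data.Nat.LCM using (lcm; lcm-least; gcd*lcm)
  open import Data.Nat.Primality.Factorisation using (factorise; PrimeFactorisation)
  open import Data.Nat.Combinatorics using (_C_; k![n∸k]!∣n!)
  open import Data.Nat.Combinatorics.Specification using (nCk≡n!/k![n-k]!)
  open import Data.Nat.DivMod using (m/n*n≡m; m%n<n; m≡m%n+[m/n]*n)
  open import Data.List.Relation.Unary.All using ([]; _∷_)

  prime>1 : ∀ {p} → Prime p → 1 < p
  prime>1 (prime _) = nonTrivial⇒n>1 _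

  prime∣prime⇒≡ : ∀ {q p} → Prime q → Prime p → q ∣ p → q ≡ p
  prime∣prime⇒≡ q-prime p-prime q∣p with prime⇒irreducible p-prime q∣p
  ... | inj₁ refl = contradiction q-prime ¬prime[1]
  ... | inj₂ q≡p  = q≡p

  prime∣^⇒∣ : ∀ {q r} → Prime q → ∀ e → q ∣ r ^ e → q ∣ r
  prime∣^⇒∣ q-prime zero    q∣1 = contradiction (∣1⇒≡1 q∣1) (>⇒≢ (prime>1 q-prime))
  prime∣^⇒∣ q-prime (suc e) q∣r^1+e with euclidsLemma _ _ q-prime q∣r^1+e
  ... | inj₁ q∣r   = q∣r
  ... | inj₂ q∣r^e = prime∣^⇒∣ q-prime e q∣r^e

  odd-prime⇒≡1+2h : ∀ {p} → Prime p → p ≢ 2 → ∃[ h ] p ≡ suc (2 * h)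
  odd-prime⇒≡1+2h {p} p-prime p≢2 with p % 2 in p%2≡r | m%n<n p 2
  ... | 0       | _ = contradiction (sym (prime∣prime⇒≡ prime[2] p-prime (m%n≡0⇒n∣m p 2 p%2≡r))) p≢2
  ... | 1       | _ = p / 2 , trans (m≡m%n+[m/n]*n p 2) (cong₂ _+_ p%2≡r (*-comm (p / 2) 2))
  ... | 2+ _    | s≤s (s≤s ())

  prime∤⇒coprime : ∀ {p n} → Prime p → ¬ p ∣ n → Coprime p n
  prime∤⇒coprime p-prime p∤n (d∣p , d∣n) with prime⇒irreducible p-prime d∣p
  ... | inj₁ d≡1 = d≡1
  ... | inj₂ refl = contradiction d∣n p∤n

  coprime-*ˡ : ∀ {a b c} → Coprime a c → Coprime b c → Coprime (a * b) c
  coprime-*ˡ {a} a⊥c b⊥c (d∣ab , d∣c) = b⊥c (coprime-divisor d⊥a d∣ab , d∣c)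
    where
    d⊥a : Coprime _ a
    d⊥a (e∣d , e∣a) = a⊥c (e∣a , ∣-trans e∣d d∣c)

  coprime-^ˡ : ∀ {a c} → Coprime a c → ∀ e → Coprime (a ^ e) c
  coprime-^ˡ {c = c} a⊥c zero    = 1-coprimeTo c
  coprime-^ˡ         a⊥c (suc e) = coprime-*ˡ a⊥c (coprime-^ˡ a⊥c e)

  coprime⇒*∣ : ∀ {a b n} → Coprime a b → a ∣ n → b ∣ n → a * b ∣ n
  coprime⇒*∣ {a} {b} a⊥b a∣n b∣n = subst (_∣ _) lcm≡ab (lcm-least a∣n b∣n)
    where
    lcm≡ab : lcm a b ≡ a * b
    lcm≡ab = trans (sym (*-identityˡ _))
                   (subst (λ g → g * lcm a b ≡ a * b) (coprime⇒gcd≡1 a⊥b) (gcd*lcm a b))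

  prime-divisor : ∀ {n} → 1 < n → ∃[ q ] Prime q × q ∣ n
  prime-divisor {n} 1<n with factorise n {{>-nonZero (<-trans z<s 1<n)}}
  ... | record { factors = [] ; isFactorisation = n≡1 } = contradiction n≡1 (>⇒≢ 1<n)
  ... | record { factors = q ∷ qs ; isFactorisation = n≡q*Πqs ; factorsPrime = q-prime ∷ _ } =
    q , q-prime , divides (product qs) (trans n≡q*Πqs (*-comm q (product qs)))

  gcd-closed : (P : ℕ → Set) →
               (∀ k a → P a → P (k * a)) → (∀ a b → P a → P (a + b) → P b) →
               ∀ m n → P m → P n → P (gcd m n)
  gcd-closed P P-* P-∸ m n Pm Pn with Bézout.identity (gcd-GCD m n)
  ... | Bézout.+- x y d+yn≡xm =
    P-∸ (y * n) _ (P-* y n Pn) (subst P (trans (sym d+yn≡xm) (+-comm _ (y * n))) (P-* x m Pm))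
  ... | Bézout.-+ x y d+xm≡yn =
    P-∸ (x * m) _ (P-* x m Pm) (subst P (trans (sym d+xm≡yn) (+-comm _ (x * m))) (P-* y n Pn))

  ∣4⇒∣2⊎≡4 : ∀ {d} → d ∣ 4 → d ∣ 2 ⊎ d ≡ 4
  ∣4⇒∣2⊎≡4 {0} 0∣4 = contradiction (0∣⇒≡0 0∣4) λ ()
  ∣4⇒∣2⊎≡4 {1} _   = inj₁ (1∣ 2)
  ∣4⇒∣2⊎≡4 {2} _   = inj₁ ∣-refl
  ∣4⇒∣2⊎≡4 {3} 3∣4 = contradiction 3∣4 (toWitnessFalse {a? = 3 ∣? 4} _)
  ∣4⇒∣2⊎≡4 {4} _   = inj₂ refl
  ∣4⇒∣2⊎≡4 {suc (suc (suc (suc (suc _))))} d∣4 =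
    contradiction (∣⇒≤ d∣4) λ { (s≤s (s≤s (s≤s (s≤s ())))) }

  valuation : ∀ {r} → 1 < r → ∀ n → .{{NonZero n}} →
              ∃[ e ] ∃[ n′ ] n ≡ r ^ e * n′ × ¬ r ∣ n′
  valuation {r} 1<r n = go n (<-wellFounded n)
    where
    instance _ = n>1⇒nonTrivial 1<r
    go : ∀ n → .{{NonZero n}} → Acc _<_ n → ∃[ e ] ∃[ n′ ] n ≡ r ^ e * n′ × ¬ r ∣ n′
    go n (acc rec) with r ∣? n
    ... | no  r∤n = 0 , n , sym (+-identityʳ n) , r∤n
    ... | yes r∣n with go (quotient r∣n) {{quotient≢0 r∣n}} (rec (quotient-< r∣n))
    ...   | e , n′ , q≡r^e*n′ , r∤n′ = suc e , n′ , n≡r^1+e*n′ , r∤n′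
      where
      n≡r^1+e*n′ : n ≡ r ^ suc e * n′
      n≡r^1+e*n′ = trans (m∣n⇒n≡m*quotient r∣n)
                         (trans (cong (r *_) q≡r^e*n′) (sym (*-assoc r (r ^ e) n′)))

  prime∤! : ∀ {p} → Prime p → ∀ {k} → k < p → ¬ p ∣ k !
  prime∤! p-prime {zero}  _   p∣1 = contradiction (∣1⇒≡1 p∣1) (>⇒≢ (prime>1 p-prime))
  prime∤! p-prime {suc k} k<p p∣k! with euclidsLemma (suc k) (k !) p-prime p∣k!
  ... | inj₁ p∣1+k = >⇒∤ k<p p∣1+k
  ... | inj₂ p∣k!  = prime∤! p-prime (<-trans (n<1+n k) k<p) p∣k!

  n∣n! : ∀ n → .{{NonZero n}} → n ∣ n !
  n∣n! (suc n) = divides (n !) (*-comm (suc n) (n !))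

  prime∣C : ∀ {p k} → Prime p → 0 < k → k < p → p ∣ p C k
  prime∣C {p} {k} p-prime 0<k k<p with euclidsLemma (p C k) k![p∸k]! p-prime p∣C*k![p∸k]!
    where
    k![p∸k]! = k ! * (p ∸ k) !
    C*k![p∸k]!≡p! : (p C k) * k![p∸k]! ≡ p !
    C*k![p∸k]!≡p! = begin
      (p C k) * k![p∸k]!              ≡⟨ cong (_* k![p∸k]!) (nCk≡n!/k![n-k]! (<⇒≤ k<p)) ⟩
      (p ! / k![p∸k]!) * k![p∸k]!     ≡⟨ m/n*n≡m (k![n∸k]!∣n! (<⇒≤ k<p)) ⟩
      p !                             ∎
      where open ≡-Reasoning; instance _ = k !* (p ∸ k) !≢0
    p∣C*k![p∸k]! : p ∣ (p C k) * k![p∸k]!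
    p∣C*k![p∸k]! = subst (p ∣_) (sym C*k![p∸k]!≡p!) (n∣n! p {{prime⇒nonZero p-prime}})
  ... | inj₁ p∣C            = p∣C
  ... | inj₂ p∣k![p∸k]! with euclidsLemma (k !) ((p ∸ k) !) p-prime p∣k![p∸k]!
  ...   | inj₁ p∣k!     = contradiction p∣k! (prime∤! p-prime k<p)
  ...   | inj₂ p∣[p∸k]! = contradiction p∣[p∸k]! (prime∤! p-prime (∸-monoʳ-< 0<k (<⇒≤ k<p)))

-- Quotients of commutative semirings by congruences

module _ {A : Set} {_+_ _*_ : Op₂ A} {0# 1# : A} where

  quotient-isCommutativeSemiring : IsCommutativeSemiring _≡_ _+_ _*_ 0# 1# →
    ∀ {_∼_ : Rel A 0ℓ} → IsEquivalence _∼_ → Congruent₂ _∼_ _+_ → Congruent₂ _∼_ _*_ →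
    IsCommutativeSemiring _∼_ _+_ _*_ 0# 1#
  quotient-isCommutativeSemiring isCS ∼-isEquivalence ∼-+-cong ∼-*-cong = record
    { isSemiring = record
      { isSemiringWithoutAnnihilatingZero = record
        { +-isCommutativeMonoid = record
          { isMonoid = record
            { isSemigroup = record
              { isMagma = record { isEquivalence = ∼-isEquivalence ; ∙-cong = ∼-+-cong }
              ; assoc = λ x y z → reflexive (+-assoc x y z) }
            ; identity = (reflexive ∘ +-identityˡ) , (reflexive ∘ +-identityʳ) }
          ; comm = λ x y → reflexive (+-comm x y) }
        ; *-cong = ∼-*-cong
        ; *-assoc = λ x y z → reflexive (*-assoc x y z)
        ; *-identity = (reflexive ∘ *-identityˡ) , (reflexive ∘ *-identityʳ)
        ; distrib = (λ x y z → reflexive (distribˡ x y z))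
                  , (λ x y z → reflexive (distribʳ x y z)) }
      ; zero = (reflexive ∘ zeroˡ) , (reflexive ∘ zeroʳ) }
    ; *-comm = λ x y → reflexive (*-comm x y) }
    where
    open IsCommutativeSemiring isCS
      using (+-assoc; +-identityˡ; +-identityʳ; +-comm; *-assoc; *-identityˡ; *-identityʳ;
             distribˡ; distribʳ; zeroˡ; zeroʳ; *-comm)
    open IsEquivalence ∼-isEquivalence using (reflexive)

-- Frobenius in characteristic p

module _ {a ℓ} (S : CommutativeSemiring a ℓ) where
  open CommutativeSemiring S hiding (refl; sym; zero) renaming (trans to ≈-trans)
  open import Data.Nat.Base as ℕ using (_∸_)
  open import Data.Nat.Combinatorics using (_C_; nCn≡1)
  open import Data.Nat.Divisibility using (_∣_; divides)
  open import Data.Fin.Base using (zero; suc; toℕ; inject₁; fromℕ)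
  open import Data.Fin.Properties using (inject₁ℕ<; toℕ-fromℕ)
  open import Data.Nat.Properties using (n∸n≡0)
  open import Algebra.Properties.Semiring.Exp semiring using (_^_)
  open import Algebra.Properties.Semiring.Mult semiring
    using (×-congʳ; ×-assoc-*; ×1-homo-*) renaming (_×_ to _·_)
  open import Algebra.Properties.Monoid.Sum +-monoid
    using (sum; sum-cong-≋; sum-init-last; sum-replicate-zero)
  open import Algebra.Properties.CommutativeSemiring.Binomial S
    using (binomialTerm) renaming (theorem to binomial-theorem)
  open import Relation.Binary.Reasoning.Setoid setoid

  ∣⇒·≈0# : ∀ {p c} → p · 1# ≈ 0# → p ∣ c → ∀ x → c · x ≈ 0#
  ∣⇒·≈0# {p} p·1≈0 (divides q refl) x = begin
    (q ℕ.* p) · x                 ≈⟨ ×-congʳ (q ℕ.* p) (*-identityˡ x) ⟨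
    (q ℕ.* p) · (1# * x)          ≈⟨ ×-assoc-* (q ℕ.* p) 1# x ⟨
    ((q ℕ.* p) · 1#) * x          ≈⟨ *-congʳ (×1-homo-* q p) ⟩
    ((q · 1#) * (p · 1#)) * x     ≈⟨ *-congʳ (*-congˡ p·1≈0) ⟩
    ((q · 1#) * 0#) * x           ≈⟨ *-congʳ (zeroʳ (q · 1#)) ⟩
    0# * x                        ≈⟨ zeroˡ x ⟩
    0#                            ∎

  frobenius : ∀ {p} → Prime p → p · 1# ≈ 0# → ∀ x y → (x + y) ^ p ≈ x ^ p + y ^ p
  frobenius {zero}   p-prime = contradiction p-prime ¬prime[0]
  frobenius {suc p′} p-prime p·1≈0 x y = begin
    (x + y) ^ p                                    ≈⟨ binomial-theorem p x y ⟩
    term zero + sum (λ i → term (suc i))           ≈⟨ +-congˡ (sum-init-last (λ i → term (suc i))) ⟩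
    term zero + (sum (λ i → term (suc (inject₁ i))) + term (suc (fromℕ p′)))
                                                   ≈⟨ +-cong first (+-cong middle last) ⟩
    y ^ p + (0# + x ^ p)                           ≈⟨ +-congˡ (+-identityˡ (x ^ p)) ⟩
    y ^ p + x ^ p                                  ≈⟨ +-comm (y ^ p) (x ^ p) ⟩
    x ^ p + y ^ p                                  ∎
    where
    p = suc p′
    term = binomialTerm x y p
    first : term zero ≈ y ^ p
    first = ≈-trans (+-identityʳ _) (*-identityˡ (y ^ p))
    middle : sum (λ i → term (suc (inject₁ i))) ≈ 0#
    middle = ≈-trans
      (sum-cong-≋ λ i → ∣⇒·≈0# p·1≈0 (prime∣C p-prime ℕ.z<s (ℕ.s<s (inject₁ℕ< i))) _)
      (sum-replicate-zero p′)
    last : term (suc (fromℕ p′)) ≈ x ^ p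
    last = begin
      term (suc (fromℕ p′))
        ≡⟨ cong (λ k → (p C k) · (x ^ k * y ^ (p ∸ k))) (cong suc (toℕ-fromℕ p′)) ⟩
      (p C p) · (x ^ p * y ^ (p ∸ p))
        ≡⟨ cong₂ (λ c k → c · (x ^ p * y ^ k)) (nCn≡1 p) (n∸n≡0 p) ⟩
      1 · (x ^ p * 1#)
        ≈⟨ +-identityʳ _ ⟩
      x ^ p * 1#
        ≈⟨ *-identityʳ (x ^ p) ⟩
      x ^ p
        ∎

-- Congruences of integers

module _ where
  open import Data.Integer.Base using (_+_; _-_; _*_; -_; _^_)
  open import Data.Integer.Properties using (+-inverseʳ)
  open import Data.Integer.Divisibility.Signed
  import Data.Nat.Base as ℕ
  import Data.Nat.Divisibility as ℕ
  import Data.Nat.Properties as ℕ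
  open import Data.Nat.DivMod using (m≡m%n+[m/n]*n; %-remove-+ʳ)

  infix 4 _≈_mod_
  record _≈_mod_ (a b : ℤ) (M : ℕ) : Set where
    constructor congruent
    field divides-difference : + M ∣ a - b
  open _≈_mod_ public

  ≈-mod-reflexive : ∀ {M a b} → a ≡ b → a ≈ b mod M
  ≈-mod-reflexive {a = a} refl = congruent (divides 0ℤ (+-inverseʳ a))

  ≈-mod-refl : ∀ {M a} → a ≈ a mod M
  ≈-mod-refl = ≈-mod-reflexive refl

  ≈-mod-sym : ∀ {M a b} → a ≈ b mod M → b ≈ a mod M
  ≈-mod-sym {M} {a} {b} (congruent d) = congruent $ begin
    + M         ∣⟨ ∣m⇒∣-m d ⟩
    - (a - b)   ≡⟨ solve (a ∷ b ∷ []) ⟩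
    b - a       ∎
    where open ∣-Reasoning

  ≈-mod-trans : ∀ {M a b c} → a ≈ b mod M → b ≈ c mod M → a ≈ c mod M
  ≈-mod-trans {M} {a} {b} {c} (congruent d) (congruent e) = congruent $ begin
    + M                 ∣⟨ ∣m∣n⇒∣m+n d e ⟩
    (a - b) + (b - c)   ≡⟨ solve (a ∷ b ∷ c ∷ []) ⟩
    a - c               ∎
    where open ∣-Reasoning

  ≈-mod-isEquivalence : ∀ M → IsEquivalence (λ a b → a ≈ b mod M)
  ≈-mod-isEquivalence M = record { refl = ≈-mod-refl ; sym = ≈-mod-sym ; trans = ≈-mod-trans }

  ≈-mod-setoid : ℕ → Setoid _ _
  ≈-mod-setoid M = record { isEquivalence = ≈-mod-isEquivalence M }

  module ≈-mod-Reasoning (M : ℕ) = SetoidReasoning (≈-mod-setoid M)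

  +-cong-mod : ∀ {M a b c d} → a ≈ b mod M → c ≈ d mod M → a + c ≈ b + d mod M
  +-cong-mod {M} {a} {b} {c} {d} (congruent ab) (congruent cd) = congruent $ begin
    + M                 ∣⟨ ∣m∣n⇒∣m+n ab cd ⟩
    (a - b) + (c - d)   ≡⟨ solve (a ∷ b ∷ c ∷ d ∷ []) ⟩
    (a + c) - (b + d)   ∎
    where open ∣-Reasoning

  neg-cong-mod : ∀ {M a b} → a ≈ b mod M → - a ≈ - b mod M
  neg-cong-mod {M} {a} {b} (congruent ab) = congruent $ begin
    + M           ∣⟨ ∣m⇒∣-m ab ⟩
    - (a - b)     ≡⟨ solve (a ∷ b ∷ []) ⟩
    - a - - b     ∎
    where open ∣-Reasoning

  *-cong-mod : ∀ {M a b c d} → a ≈ b mod M → c ≈ d mod M → a * c ≈ b * d mod M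
  *-cong-mod {M} {a} {b} {c} {d} (congruent ab) (congruent cd) = congruent $ begin
    + M                       ∣⟨ ∣m∣n⇒∣m+n (∣m⇒∣m*n c ab) (∣n⇒∣m*n b cd) ⟩
    (a - b) * c + b * (c - d) ≡⟨ solve (a ∷ b ∷ c ∷ d ∷ []) ⟩
    a * c - b * d             ∎
    where open ∣-Reasoning

  *-congˡ-mod : ∀ {M a b} c → a ≈ b mod M → c * a ≈ c * b mod M
  *-congˡ-mod c = *-cong-mod (≈-mod-refl {a = c})

  ^-cong-mod : ∀ {M a b} n → a ≈ b mod M → a ^ n ≈ b ^ n mod M
  ^-cong-mod zero    ab = ≈-mod-refl
  ^-cong-mod (suc n) ab = *-cong-mod ab (^-cong-mod n ab)

  ∣⇒≈0-mod : ∀ {M a} → + M ∣ a → a ≈ 0ℤ mod M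
  ∣⇒≈0-mod {a = a} d = congruent (subst (_ ∣_) (sym (ℤ.+-identityʳ a)) d)

  ≈0-mod⇒∣ : ∀ {M a} → a ≈ 0ℤ mod M → + M ∣ a
  ≈0-mod⇒∣ {a = a} (congruent d) = subst (_ ∣_) (ℤ.+-identityʳ a) d

  ≈-mod-1 : ∀ {a b} → a ≈ b mod 1
  ≈-mod-1 {a} {b} = congruent (divides (a - b) (sym (ℤ.*-identityʳ (a - b))))

  ≈-mod-∣ : ∀ {d M a b} → d ℕ.∣ M → a ≈ b mod M → a ≈ b mod d
  ≈-mod-∣ d∣M (congruent M∣a-b) = congruent (∣-trans (∣ᵤ⇒∣ d∣M) M∣a-b)

  ≈-mod-coprime-* : ∀ {M N a b} → Coprime M N →
                    a ≈ b mod M → a ≈ b mod N → a ≈ b mod (M ℕ.* N)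
  ≈-mod-coprime-* M⊥N (congruent M∣a-b) (congruent N∣a-b) =
    congruent (∣ᵤ⇒∣ (coprime⇒*∣ M⊥N (∣⇒∣ᵤ M∣a-b) (∣⇒∣ᵤ N∣a-b)))

  euclidsLemmaℤ : ∀ {p} a b → Prime p → + p ∣ a * b → (+ p ∣ a) ⊎ (+ p ∣ b)
  euclidsLemmaℤ {p} a b p-prime p∣ab =
    Sum.map ∣ᵤ⇒∣ ∣ᵤ⇒∣
      (euclidsLemma ∣ a ∣ ∣ b ∣ p-prime (subst (p ℕ.∣_) (ℤ.abs-* a b) (∣⇒∣ᵤ p∣ab)))

  prime∤^ : ∀ {p a} → Prime p → ¬ + p ∣ a → ∀ n → ¬ + p ∣ a ^ n
  prime∤^ p-prime p∤a zero    p∣1 =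
    contradiction (ℕ.∣1⇒≡1 (∣⇒∣ᵤ p∣1)) (ℕ.>⇒≢ (prime>1 p-prime))
  prime∤^ p-prime p∤a (suc n) p∣a^1+n =
    [ p∤a , prime∤^ p-prime p∤a n ]′ (euclidsLemmaℤ _ _ p-prime p∣a^1+n)

  prime∣*⇒∣ʳ : ∀ {p} a {b} → Prime p → ¬ (+ p ∣ a) → + p ∣ a * b → + p ∣ b
  prime∣*⇒∣ʳ a {b} p-prime p∤a p∣ab =
    [ flip contradiction p∤a , id ]′ (euclidsLemmaℤ a b p-prime p∣ab)

  prime≢2⇒∤2 : ∀ {p} → Prime p → p ≢ 2 → ¬ + p ∣ + 2
  prime≢2⇒∤2 p-prime p≢2 p∣2 = p≢2 (prime∣prime⇒≡ p-prime prime[2] (∣⇒∣ᵤ p∣2))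

  *-cancelˡ-mod : ∀ {p} c {a b} → Prime p → ¬ + p ∣ c → c * a ≈ c * b mod p → a ≈ b mod p
  *-cancelˡ-mod {p} c {a} {b} p-prime p∤c (congruent p∣ca-cb) =
    congruent (prime∣*⇒∣ʳ c p-prime p∤c p∣c[a-b])
    where
    p∣c[a-b] : + p ∣ c * (a - b)
    p∣c[a-b] = begin
      + p           ∣⟨ p∣ca-cb ⟩
      c * a - c * b ≡⟨ solve (c ∷ a ∷ b ∷ []) ⟩
      c * (a - b)   ∎
      where open ∣-Reasoning

  +-∣-≈-mod : ∀ {M} a {c} → + M ∣ c → a + c ≈ a mod M
  +-∣-≈-mod {M} a {c} M∣c = congruent $ begin
    + M           ∣⟨ M∣c ⟩
    c             ≡⟨ solve (a ∷ c ∷ []) ⟩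
    (a + c) - a   ∎
    where open ∣-Reasoning

  +-*-≈-mod : ∀ {M} a k → + (a ℕ.+ k ℕ.* M) ≈ + a mod M
  +-*-≈-mod {M} a k =
    subst (_≈ + a mod M) (sym +[a+kM]≡+a++k*+M) (+-∣-≈-mod (+ a) (∣n⇒∣m*n (+ k) ∣-refl))
    where
    +[a+kM]≡+a++k*+M : + (a ℕ.+ k ℕ.* M) ≡ + a + + k * + M
    +[a+kM]≡+a++k*+M = trans (ℤ.pos-+ a (k ℕ.* M)) (cong (λ c → + a + c) (ℤ.pos-* k M))

  %≡%⇒≈-mod : ∀ {M} .{{_ : NonZero M}} a b → a ℕ.% M ≡ b ℕ.% M → + a ≈ + b mod M
  %≡%⇒≈-mod {M} a b a%M≡b%M = begin
    + a                               ≡⟨ cong +_ (m≡m%n+[m/n]*n a M) ⟩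
    + (a ℕ.% M ℕ.+ (a ℕ./ M) ℕ.* M)   ≈⟨ +-*-≈-mod (a ℕ.% M) (a ℕ./ M) ⟩
    + (a ℕ.% M)                       ≡⟨ cong +_ a%M≡b%M ⟩
    + (b ℕ.% M)                       ≈⟨ +-*-≈-mod (b ℕ.% M) (b ℕ./ M) ⟨
    + (b ℕ.% M ℕ.+ (b ℕ./ M) ℕ.* M)   ≡⟨ cong +_ (m≡m%n+[m/n]*n b M) ⟨
    + b                               ∎
    where open ≈-mod-Reasoning M

  ≈-mod⇒%≡% : ∀ {M} .{{_ : NonZero M}} a b → + a ≈ + b mod M → a ℕ.% M ≡ b ℕ.% M
  ≈-mod⇒%≡% {M} a b a≈b =
    [ (λ a≤b → sym (≤⇒%≡% a≤b (≈-mod-sym a≈b)))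
    , (λ b≤a → ≤⇒%≡% b≤a a≈b)
    ]′ (ℕ.≤-total a b)
    where
    ≤⇒%≡% : ∀ {a b} → a ℕ.≤ b → + b ≈ + a mod M → b ℕ.% M ≡ a ℕ.% M
    ≤⇒%≡% {a} {b} a≤b (congruent M∣b-a) = begin
      b ℕ.% M                   ≡⟨ cong (ℕ._% M) (ℕ.m+[n∸m]≡n a≤b) ⟨
      (a ℕ.+ (b ℕ.∸ a)) ℕ.% M   ≡⟨ %-remove-+ʳ a M∣b∸a ⟩
      a ℕ.% M                   ∎
      where
      open ≡-Reasoning
      M∣b∸a : M ℕ.∣ b ℕ.∸ a
      M∣b∸a = ∣⇒∣ᵤ (subst (+ M ∣_) (trans (ℤ.[+m]-[+n]≡m⊖n b a) (ℤ.⊖-≥ a≤b)) M∣b-a)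

  square≈1⇒≈±1 : ∀ {p} e → Prime p → e * e ≈ 1ℤ mod p → e ≈ 1ℤ mod p ⊎ e ≈ -1ℤ mod p
  square≈1⇒≈±1 {p} e p-prime (congruent p∣e²-1) =
    Sum.map congruent (λ p∣e+1 → congruent (subst (+ p ∣_) e+1≡e-[-1] p∣e+1))
      (euclidsLemmaℤ (e - 1ℤ) (e + 1ℤ) p-prime (subst (+ p ∣_) e²-1≡[e-1][e+1] p∣e²-1))
    where
    e²-1≡[e-1][e+1] : e * e - 1ℤ ≡ (e - 1ℤ) * (e + 1ℤ)
    e²-1≡[e-1][e+1] = solve (e ∷ [])
    e+1≡e-[-1] : e + 1ℤ ≡ e - -1ℤ
    e+1≡e-[-1] = solve (e ∷ [])

  ℤ/_ : ℕ → CommutativeSemiring 0ℓ 0ℓ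
  ℤ/ M = record
    { isCommutativeSemiring = quotient-isCommutativeSemiring ℤ.+-*-isCommutativeSemiring
                                (≈-mod-isEquivalence M) +-cong-mod *-cong-mod }

  fermat : ∀ {p} → Prime p → ∀ n → (+ n) ^ p ≈ + n mod p
  fermat {p} p-prime zero = ≈-mod-reflexive (0^p≡0 p (prime>1 p-prime))
    where
    0^p≡0 : ∀ p → 1 ℕ.< p → 0ℤ ^ p ≡ 0ℤ
    0^p≡0 (suc p) _ = refl
  fermat {p} p-prime (suc n) = begin
    (+ suc n) ^ p        ≡⟨ cong (_^ p) (ℤ.pos-+ 1 n) ⟩
    (1ℤ + + n) ^ p       ≡⟨ ^≡^ (1ℤ + + n) p ⟨
    (1ℤ + + n) ^ᵖ p      ≈⟨ frobenius (ℤ/ p) p-prime p·1≈0 1ℤ (+ n) ⟩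
    1ℤ ^ᵖ p + (+ n) ^ᵖ p ≡⟨ cong₂ _+_ (trans (^≡^ 1ℤ p) (ℤ.^-zeroˡ p)) (^≡^ (+ n) p) ⟩
    1ℤ + (+ n) ^ p       ≈⟨ +-cong-mod (≈-mod-refl {a = 1ℤ}) (fermat p-prime n) ⟩
    1ℤ + + n             ≡⟨ ℤ.pos-+ 1 n ⟨
    + suc n              ∎
    where
    open ≈-mod-Reasoning p
    open CommutativeSemiring (ℤ/ p) using (semiring; +-rawMonoid)
    open import Algebra.Properties.Semiring.Exp semiring using () renaming (_^_ to _^ᵖ_)
    open import Algebra.Definitions.RawMonoid +-rawMonoid using () renaming (_×_ to _·_)
    ^≡^ : ∀ a n → a ^ᵖ n ≡ a ^ n
    ^≡^ a zero    = refl
    ^≡^ a (suc n) = cong (a *_) (^≡^ a n)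
    n·1≡n : ∀ n → n · 1ℤ ≡ + n
    n·1≡n zero    = refl
    n·1≡n (suc n) = trans (cong (λ a → 1ℤ + a) (n·1≡n n)) (sym (ℤ.pos-+ 1 n))
    p·1≈0 : p · 1ℤ ≈ 0ℤ mod p
    p·1≈0 = ≈-mod-trans (≈-mod-reflexive (n·1≡n p)) (∣⇒≈0-mod ∣-refl)

-- The ring ℤ[T]/(T² - κ T - 1)

module QuadraticRing (κ : ℤ) where
  open import Data.Integer.Base using (_+_; _-_; _*_; -_) renaming (_^_ to _^ℤ_)
  open import Data.Integer.Divisibility.Signed using (_∣_; divides; ∣-refl; ∣ᵤ⇒∣; ∣⇒∣ᵤ)
  import Data.Nat.Base as ℕ
  open import Data.Nat.Base using () renaming (_^_ to _^ℕ_)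
  import Data.Nat.Divisibility as ℕ
  import Data.Nat.Properties as ℕ
  open import Data.Nat.GCD using (gcd; gcd[m,n]∣m; gcd[m,n]∣n; c*gcd[m,n]≡gcd[cm,cn])
  open import Data.Nat.Coprimality using (coprime⇒gcd≡1)

  -- mk a b stands for a + b T, and T² = κ T + 1.
  data R : Set where
    mk : ℤ → ℤ → R

  c₀ c₁ : R → ℤ
  c₀ (mk a _) = a
  c₁ (mk _ b) = b

  infixl 6 _⊕_
  infixl 7 _⊗_

  _⊕_ : R → R → R
  mk a b ⊕ mk c d = mk (a + c) (b + d)

  _⊗_ : R → R → R
  mk a b ⊗ mk c d = mk (a * c + b * d) (a * d + b * c + κ * b * d)

  ι : ℤ → R
  ι a = mk a 0ℤ

  𝟘 𝟙 T : R
  𝟘 = ι 0ℤ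
  𝟙 = ι 1ℤ
  T = mk 0ℤ 1ℤ

  ⊕-assoc : ∀ x y z → (x ⊕ y) ⊕ z ≡ x ⊕ (y ⊕ z)
  ⊕-assoc (mk a b) (mk c d) (mk e f) =
    cong₂ mk (solve (a ∷ c ∷ e ∷ [])) (solve (b ∷ d ∷ f ∷ []))

  ⊕-comm : ∀ x y → x ⊕ y ≡ y ⊕ x
  ⊕-comm (mk a b) (mk c d) = cong₂ mk (ℤ.+-comm a c) (ℤ.+-comm b d)

  ⊕-identityˡ : ∀ x → 𝟘 ⊕ x ≡ x
  ⊕-identityˡ (mk a b) = cong₂ mk (ℤ.+-identityˡ a) (ℤ.+-identityˡ b)

  ⊗-assoc : ∀ x y z → (x ⊗ y) ⊗ z ≡ x ⊗ (y ⊗ z)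
  ⊗-assoc (mk a b) (mk c d) (mk e f) =
    cong₂ mk (solve (κ ∷ a ∷ b ∷ c ∷ d ∷ e ∷ f ∷ []))
             (solve (κ ∷ a ∷ b ∷ c ∷ d ∷ e ∷ f ∷ []))

  ⊗-comm : ∀ x y → x ⊗ y ≡ y ⊗ x
  ⊗-comm (mk a b) (mk c d) =
    cong₂ mk (solve (a ∷ b ∷ c ∷ d ∷ [])) (solve (κ ∷ a ∷ b ∷ c ∷ d ∷ []))

  ⊗-identityˡ : ∀ x → 𝟙 ⊗ x ≡ x
  ⊗-identityˡ (mk a b) = cong₂ mk (solve (a ∷ b ∷ [])) (solve (κ ∷ a ∷ b ∷ []))

  ⊗-distribʳ-⊕ : ∀ x y z → (y ⊕ z) ⊗ x ≡ y ⊗ x ⊕ z ⊗ x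
  ⊗-distribʳ-⊕ (mk a b) (mk c d) (mk e f) =
    cong₂ mk (solve (a ∷ b ∷ c ∷ d ∷ e ∷ f ∷ [])) (solve (κ ∷ a ∷ b ∷ c ∷ d ∷ e ∷ f ∷ []))

  ⊗-zeroˡ : ∀ x → 𝟘 ⊗ x ≡ 𝟘
  ⊗-zeroˡ (mk a b) = cong₂ mk (solve (a ∷ b ∷ [])) (solve (κ ∷ a ∷ b ∷ []))

  R-isCommutativeSemiring : IsCommutativeSemiring _≡_ _⊕_ _⊗_ 𝟘 𝟙
  R-isCommutativeSemiring = isCommutativeSemiringˡ record
    { +-isCommutativeMonoid = isCommutativeMonoidˡ record
      { isSemigroup = record
        { isMagma = record { isEquivalence = isEquivalence ; ∙-cong = cong₂ _⊕_ }
        ; assoc = ⊕-assoc }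
      ; identityˡ = ⊕-identityˡ
      ; comm = ⊕-comm }
    ; *-isCommutativeMonoid = isCommutativeMonoidˡ record
      { isSemigroup = record
        { isMagma = record { isEquivalence = isEquivalence ; ∙-cong = cong₂ _⊗_ }
        ; assoc = ⊗-assoc }
      ; identityˡ = ⊗-identityˡ
      ; comm = ⊗-comm }
    ; distribʳ = ⊗-distribʳ-⊕
    ; zeroˡ = ⊗-zeroˡ
    }
    where open Algebra.Structures.Biased _≡_

  R-commutativeSemiring : CommutativeSemiring 0ℓ 0ℓ
  R-commutativeSemiring = record { isCommutativeSemiring = R-isCommutativeSemiring }

  open CommutativeSemiring R-commutativeSemiring public
    using (semiring) renaming (+-identityʳ to ⊕-identityʳ; *-identityʳ to ⊗-identityʳ; zeroʳ to ⊗-zeroʳ)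
  open import Algebra.Properties.Semiring.Exp semiring public using (_^_; ^-homo-*; ^-assocʳ)
  open import Algebra.Properties.CommutativeSemiring.Exp R-commutativeSemiring public using (^-distrib-*)

  infix 4 _≋_mod_
  record _≋_mod_ (x y : R) (M : ℕ) : Set where
    constructor ⟨_,_⟩
    field
      c₀-≈ : c₀ x ≈ c₀ y mod M
      c₁-≈ : c₁ x ≈ c₁ y mod M
  open _≋_mod_ public

  ≋-mod-isEquivalence : ∀ M → IsEquivalence (λ x y → x ≋ y mod M)
  ≋-mod-isEquivalence M = record
    { refl  = ⟨ ≈-mod-refl , ≈-mod-refl ⟩
    ; sym   = λ (⟨ p , q ⟩) → ⟨ ≈-mod-sym p , ≈-mod-sym q ⟩
    ; trans = λ (⟨ p , q ⟩) (⟨ p′ , q′ ⟩) → ⟨ ≈-mod-trans p p′ , ≈-mod-trans q q′ ⟩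
    }

  ≋-mod-reflexive : ∀ {M x y} → x ≡ y → x ≋ y mod M
  ≋-mod-reflexive {M} = IsEquivalence.reflexive (≋-mod-isEquivalence M)

  ≋-mod-refl : ∀ {M x} → x ≋ x mod M
  ≋-mod-refl = ≋-mod-reflexive refl

  ≋-mod-trans : ∀ {M x y z} → x ≋ y mod M → y ≋ z mod M → x ≋ z mod M
  ≋-mod-trans {M} = IsEquivalence.trans (≋-mod-isEquivalence M)

  ⊕-cong-mod : ∀ {M} → Congruent₂ (λ x y → x ≋ y mod M) _⊕_
  ⊕-cong-mod {x = mk _ _} {mk _ _} {mk _ _} {mk _ _} ⟨ p , q ⟩ ⟨ p′ , q′ ⟩ =
    ⟨ +-cong-mod p p′ , +-cong-mod q q′ ⟩

  ⊗-cong-mod : ∀ {M} → Congruent₂ (λ x y → x ≋ y mod M) _⊗_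
  ⊗-cong-mod {x = mk _ _} {mk _ _} {mk _ _} {mk _ _} ⟨ p , q ⟩ ⟨ p′ , q′ ⟩ =
    ⟨ +-cong-mod (*-cong-mod p p′) (*-cong-mod q q′)
    , +-cong-mod (+-cong-mod (*-cong-mod p q′) (*-cong-mod q p′)) (*-cong-mod (*-congˡ-mod κ q) q′) ⟩

  R/_ : ℕ → CommutativeSemiring 0ℓ 0ℓ
  R/ M = record
    { isCommutativeSemiring = quotient-isCommutativeSemiring R-isCommutativeSemiring
                                (≋-mod-isEquivalence M) ⊕-cong-mod ⊗-cong-mod }

  module ≋-mod-Reasoning (M : ℕ) = SetoidReasoning (CommutativeSemiring.setoid (R/ M))

  ^-congˡ-mod : ∀ {M x y} n → x ≋ y mod M → x ^ n ≋ y ^ n mod M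
  ^-congˡ-mod zero    x≋y = ≋-mod-refl
  ^-congˡ-mod (suc n) x≋y = ⊗-cong-mod x≋y (^-congˡ-mod n x≋y)

  ≋-mod-∣ : ∀ {d M x y} → d ℕ.∣ M → x ≋ y mod M → x ≋ y mod d
  ≋-mod-∣ d∣M ⟨ p , q ⟩ = ⟨ ≈-mod-∣ d∣M p , ≈-mod-∣ d∣M q ⟩

  ≋-mod-coprime-* : ∀ {M N x y} → Coprime M N →
                    x ≋ y mod M → x ≋ y mod N → x ≋ y mod (M ℕ.* N)
  ≋-mod-coprime-* M⊥N ⟨ p , q ⟩ ⟨ p′ , q′ ⟩ =
    ⟨ ≈-mod-coprime-* M⊥N p p′ , ≈-mod-coprime-* M⊥N q q′ ⟩

  ι-cong-mod : ∀ {M a b} → a ≈ b mod M → ι a ≋ ι b mod M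
  ι-cong-mod a≈b = ⟨ a≈b , ≈-mod-refl ⟩

  ι-⊕ : ∀ a b → ι a ⊕ ι b ≡ ι (a + b)
  ι-⊕ a b = cong (mk (a + b)) (ℤ.+-identityˡ 0ℤ)

  ι-⊗-mk : ∀ a x y → ι a ⊗ mk x y ≡ mk (a * x) (a * y)
  ι-⊗-mk a x y = cong₂ mk (solve (a ∷ x ∷ y ∷ [])) (solve (κ ∷ a ∷ x ∷ y ∷ []))

  ι-⊗ : ∀ a b → ι a ⊗ ι b ≡ ι (a * b)
  ι-⊗ a b = cong₂ mk (solve (a ∷ b ∷ [])) (solve (κ ∷ a ∷ b ∷ []))

  ι-^ : ∀ a n → ι a ^ n ≡ ι (a ^ℤ n)
  ι-^ a zero    = refl
  ι-^ a (suc n) = trans (cong (ι a ⊗_) (ι-^ a n)) (ι-⊗ a (a ^ℤ n))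

  frobenius-mod : ∀ {p} → Prime p → ∀ x y → (x ⊕ y) ^ p ≋ x ^ p ⊕ y ^ p mod p
  frobenius-mod {p} p-prime x y = begin
    (x ⊕ y) ^ p         ≡⟨ ^≡^ (x ⊕ y) p ⟨
    (x ⊕ y) ^ᵖ p        ≈⟨ frobenius (R/ p) p-prime p·𝟙≈𝟘 x y ⟩
    x ^ᵖ p ⊕ y ^ᵖ p     ≡⟨ cong₂ _⊕_ (^≡^ x p) (^≡^ y p) ⟩
    x ^ p ⊕ y ^ p       ∎
    where
    open ≋-mod-Reasoning p
    open CommutativeSemiring (R/ p) using () renaming (semiring to R/p-semiring; +-rawMonoid to R/p-+-rawMonoid)
    open import Algebra.Properties.Semiring.Exp R/p-semiring using () renaming (_^_ to _^ᵖ_)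
    open import Algebra.Definitions.RawMonoid R/p-+-rawMonoid using () renaming (_×_ to _·_)
    ^≡^ : ∀ x n → x ^ᵖ n ≡ x ^ n
    ^≡^ x zero    = refl
    ^≡^ x (suc n) = cong (x ⊗_) (^≡^ x n)
    n·𝟙≡n : ∀ n → n · 𝟙 ≡ ι (+ n)
    n·𝟙≡n zero    = refl
    n·𝟙≡n (suc n) =
      trans (cong (𝟙 ⊕_) (n·𝟙≡n n)) (trans (ι-⊕ 1ℤ (+ n)) (cong ι (sym (ℤ.pos-+ 1 n))))
    p·𝟙≈𝟘 : p · 𝟙 ≋ 𝟘 mod p
    p·𝟙≈𝟘 = ≋-mod-trans (≋-mod-reflexive (n·𝟙≡n p)) (ι-cong-mod (∣⇒≈0-mod ∣-refl))

  ι-⊗-cancel-mod : ∀ {p} c {x y} → Prime p → ¬ (+ p ∣ c) →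
                   ι c ⊗ x ≋ ι c ⊗ y mod p → x ≋ y mod p
  ι-⊗-cancel-mod c {mk x₀ x₁} {mk y₀ y₁} p-prime p∤c cx≋cy
    rewrite ι-⊗-mk c x₀ x₁ | ι-⊗-mk c y₀ y₁ =
    ⟨ *-cancelˡ-mod c p-prime p∤c (c₀-≈ cx≋cy) , *-cancelˡ-mod c p-prime p∤c (c₁-≈ cx≋cy) ⟩

  ∣⇒ι⊗≋𝟘 : ∀ {M a} → + M ∣ a → ∀ x → ι a ⊗ x ≋ 𝟘 mod M
  ∣⇒ι⊗≋𝟘 {M} {a} M∣a x = begin
    ι a ⊗ x   ≈⟨ ⊗-cong-mod (ι-cong-mod (∣⇒≈0-mod M∣a)) (≋-mod-refl {x = x}) ⟩
    𝟘 ⊗ x     ≡⟨ ⊗-zeroˡ x ⟩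
    𝟘         ∎
    where open ≋-mod-Reasoning M

  record Period (M n : ℕ) : Set where
    constructor period
    field T^n≋𝟙 : T ^ n ≋ 𝟙 mod M
  open Period public

  period-+ : ∀ {M a b} → Period M a → Period M b → Period M (a ℕ.+ b)
  period-+ {M} {a} {b} (period Tᵃ≋𝟙) (period Tᵇ≋𝟙) = period $ begin
    T ^ (a ℕ.+ b)   ≡⟨ ^-homo-* T a b ⟩
    T ^ a ⊗ T ^ b   ≈⟨ ⊗-cong-mod Tᵃ≋𝟙 Tᵇ≋𝟙 ⟩
    𝟙 ⊗ 𝟙           ≡⟨ ⊗-identityˡ 𝟙 ⟩
    𝟙               ∎
    where open ≋-mod-Reasoning M

  period-* : ∀ {M} k {a} → Period M a → Period M (k ℕ.* a)
  period-* zero    _    = period ≋-mod-refl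
  period-* (suc k) Tᵃ≋𝟙 = period-+ Tᵃ≋𝟙 (period-* k Tᵃ≋𝟙)

  period-∣ : ∀ {M a b} → a ℕ.∣ b → Period M a → Period M b
  period-∣ (ℕ.divides k refl) = period-* k

  period-∸ : ∀ {M a b} → Period M a → Period M (a ℕ.+ b) → Period M b
  period-∸ {M} {a} {b} (period Tᵃ≋𝟙) (period Tᵃ⁺ᵇ≋𝟙) = period $ begin
    T ^ b           ≡⟨ ⊗-identityˡ (T ^ b) ⟨
    𝟙 ⊗ T ^ b       ≈⟨ ⊗-cong-mod Tᵃ≋𝟙 ≋-mod-refl ⟨
    T ^ a ⊗ T ^ b   ≡⟨ ^-homo-* T a b ⟨
    T ^ (a ℕ.+ b)   ≈⟨ Tᵃ⁺ᵇ≋𝟙 ⟩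
    𝟙               ∎
    where open ≋-mod-Reasoning M

  period-gcd : ∀ {M a b} → Period M a → Period M b → Period M (gcd a b)
  period-gcd {M} {a} {b} = gcd-closed (Period M) (λ k _ → period-* k) (λ _ _ → period-∸) a b

  period-coprime-cancel : ∀ {M N p c} → Coprime p c →
                          Period M (N ℕ.* p) → Period M (N ℕ.* c) → Period M N
  period-coprime-cancel {M} {N} {p} {c} p⊥c Tᴺᵖ≋𝟙 Tᴺᶜ≋𝟙 =
    subst (Period M) gcd[Np,Nc]≡N (period-gcd Tᴺᵖ≋𝟙 Tᴺᶜ≋𝟙)
    where
    gcd[Np,Nc]≡N : gcd (N ℕ.* p) (N ℕ.* c) ≡ N
    gcd[Np,Nc]≡N = begin
      gcd (N ℕ.* p) (N ℕ.* c)   ≡⟨ c*gcd[m,n]≡gcd[cm,cn] N p c ⟨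
      N ℕ.* gcd p c             ≡⟨ cong (N ℕ.*_) (coprime⇒gcd≡1 p⊥c) ⟩
      N ℕ.* 1                   ≡⟨ ℕ.*-identityʳ N ⟩
      N                         ∎
      where open ≡-Reasoning

  period-mod-1 : ∀ n → Period 1 n
  period-mod-1 n = period ⟨ ≈-mod-1 , ≈-mod-1 ⟩

  period-mod-∣ : ∀ {d M n} → d ℕ.∣ M → Period M n → Period d n
  period-mod-∣ d∣M (period Tⁿ≋𝟙) = period (≋-mod-∣ d∣M Tⁿ≋𝟙)

  period-mod-coprime-* : ∀ {M N n} → Coprime M N → Period M n → Period N n → Period (M ℕ.* N) n
  period-mod-coprime-* M⊥N (period Tⁿ≋𝟙) (period Tⁿ≋𝟙′) =
    period (≋-mod-coprime-* M⊥N Tⁿ≋𝟙 Tⁿ≋𝟙′)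

  period-from-prime-powers : ∀ {n} M → .{{NonZero M}} →
    (∀ r e → Prime r → r ^ℕ suc e ℕ.∣ M → Period (r ^ℕ suc e) n) → Period M n
  period-from-prime-powers {n} M = go M (<-wellFounded M)
    where
    go : ∀ M → .{{NonZero M}} → Acc ℕ._<_ M →
         (∀ r e → Prime r → r ^ℕ suc e ℕ.∣ M → Period (r ^ℕ suc e) n) → Period M n
    go 1 _ _ = period-mod-1 n
    go M@(suc (suc _)) (acc rec) local with prime-divisor {M} (ℕ.s≤s (ℕ.s≤s ℕ.z≤n))
    ... | r , r-prime , r∣M with valuation (prime>1 r-prime) M
    ...   | zero , M′ , M≡1*M′ , r∤M′ =
      contradiction (subst (r ℕ.∣_) (trans M≡1*M′ (ℕ.*-identityˡ M′)) r∣M) r∤M′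
    ...   | suc e , M′ , M≡rᵉ⁺¹*M′ , r∤M′ =
      subst (λ M → Period M n) (sym M≡rᵉ⁺¹*M′)
        (period-mod-coprime-* (coprime-^ˡ (prime∤⇒coprime r-prime r∤M′) (suc e))
          (local r e r-prime (ℕ.divides M′ (trans M≡rᵉ⁺¹*M′ (ℕ.*-comm rᵉ⁺¹ M′))))
          (go M′ {{M′≢0}} (rec M′<M) λ r e r-prime rᵉ⁺¹∣M′ →
             local r e r-prime (ℕ.∣-trans rᵉ⁺¹∣M′ M′∣M)))
      where
      rᵉ⁺¹ = r ^ℕ suc e
      M′≢0 : NonZero M′
      M′≢0 = ℕ.m*n≢0⇒n≢0 rᵉ⁺¹ {{subst NonZero M≡rᵉ⁺¹*M′ _}}
      M′∣M : M′ ℕ.∣ M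
      M′∣M = ℕ.divides rᵉ⁺¹ M≡rᵉ⁺¹*M′
      M′<M : M′ ℕ.< M
      M′<M = subst (M′ ℕ.<_) (trans (ℕ.*-comm M′ rᵉ⁺¹) (sym M≡rᵉ⁺¹*M′))
               (ℕ.m<m*n M′ rᵉ⁺¹ {{M′≢0}} (ℕ.^-monoʳ-< r (prime>1 r-prime) {0} {suc e} ℕ.z<s))

  ≋-mod⇒≡⊕ι⊗ : ∀ {s x z} → x ≋ z mod s → ∃[ y ] x ≡ z ⊕ ι (+ s) ⊗ y
  ≋-mod⇒≡⊕ι⊗ {s} {mk x₀ x₁} {mk z₀ z₁} ⟨ congruent (divides q₀ eq₀) , congruent (divides q₁ eq₁) ⟩ =
    mk q₀ q₁ , (begin
      mk x₀ x₁                              ≡⟨ cong₂ mk (b+sq≡a eq₀) (b+sq≡a eq₁) ⟨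
      mk (z₀ + + s * q₀) (z₁ + + s * q₁)    ≡⟨ cong (mk z₀ z₁ ⊕_) (ι-⊗-mk (+ s) q₀ q₁) ⟨
      mk z₀ z₁ ⊕ ι (+ s) ⊗ mk q₀ q₁         ∎)
    where
    open ≡-Reasoning
    b+sq≡a : ∀ {a b q} → a - b ≡ q * + s → b + + s * q ≡ a
    b+sq≡a {a} {b} {q} a-b≡qs = begin
      b + + s * q   ≡⟨ solve (b ∷ q ∷ []) ⟩
      b + q * + s   ≡⟨ cong (λ c → b + c) a-b≡qs ⟨
      b + (a - b)   ≡⟨ solve (a ∷ b ∷ []) ⟩
      a             ∎

  [1+s·y]^-step : ∀ s j y v →
    (𝟙 ⊕ ι s ⊗ y) ⊗ (𝟙 ⊕ ι (j * s) ⊗ y ⊕ ι (s * s) ⊗ v)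
      ≡ 𝟙 ⊕ ι ((1ℤ + j) * s) ⊗ y ⊕ ι (s * s) ⊗ (ι j ⊗ y ⊗ y ⊕ v ⊕ ι s ⊗ y ⊗ v)
  [1+s·y]^-step s j (mk y₀ y₁) (mk v₀ v₁) =
    cong₂ mk (solve (κ ∷ s ∷ j ∷ y₀ ∷ y₁ ∷ v₀ ∷ v₁ ∷ []))
             (solve (κ ∷ s ∷ j ∷ y₀ ∷ y₁ ∷ v₀ ∷ v₁ ∷ []))

  [1+s·y]^-expansion : ∀ s y j →
    ∃[ v ] (𝟙 ⊕ ι s ⊗ y) ^ j ≡ 𝟙 ⊕ ι (+ j * s) ⊗ y ⊕ ι (s * s) ⊗ v
  [1+s·y]^-expansion s (mk y₀ y₁) zero =
    𝟘 , cong₂ mk (solve (s ∷ y₀ ∷ y₁ ∷ [])) (solve (κ ∷ s ∷ y₀ ∷ y₁ ∷ []))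
  [1+s·y]^-expansion s y (suc j) with v , eq ← [1+s·y]^-expansion s y j =
    v′ , (begin
      (𝟙 ⊕ ι s ⊗ y) ⊗ (𝟙 ⊕ ι s ⊗ y) ^ j
        ≡⟨ cong ((𝟙 ⊕ ι s ⊗ y) ⊗_) eq ⟩
      (𝟙 ⊕ ι s ⊗ y) ⊗ (𝟙 ⊕ ι (+ j * s) ⊗ y ⊕ ι (s * s) ⊗ v)
        ≡⟨ [1+s·y]^-step s (+ j) y v ⟩
      𝟙 ⊕ ι ((1ℤ + + j) * s) ⊗ y ⊕ ι (s * s) ⊗ v′
        ≡⟨ cong (λ c → 𝟙 ⊕ ι (c * s) ⊗ y ⊕ ι (s * s) ⊗ v′) (ℤ.pos-+ 1 j) ⟨
      𝟙 ⊕ ι (+ suc j * s) ⊗ y ⊕ ι (s * s) ⊗ v′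
        ∎)
    where
    open ≡-Reasoning
    v′ = ι (+ j) ⊗ y ⊗ y ⊕ v ⊕ ι s ⊗ y ⊗ v

  ≋𝟙⇒^≋𝟙 : ∀ {p s x} → p ℕ.∣ s → x ≋ 𝟙 mod s → x ^ p ≋ 𝟙 mod (p ℕ.* s)
  ≋𝟙⇒^≋𝟙 {p} {s} {x} p∣s x≋𝟙
    with y , x≡𝟙+sy ← ≋-mod⇒≡⊕ι⊗ x≋𝟙
    with v , [𝟙+sy]ᵖ≡ ← [1+s·y]^-expansion (+ s) y p = begin
      x ^ p                                        ≡⟨ cong (_^ p) x≡𝟙+sy ⟩
      (𝟙 ⊕ ι (+ s) ⊗ y) ^ p                        ≡⟨ [𝟙+sy]ᵖ≡ ⟩
      𝟙 ⊕ ι (+ p * + s) ⊗ y ⊕ ι (+ s * + s) ⊗ v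
        ≈⟨ ⊕-cong-mod (⊕-cong-mod {x = 𝟙} ≋-mod-refl (∣⇒ι⊗≋𝟘 ps∣ps y)) (∣⇒ι⊗≋𝟘 ps∣ss v) ⟩
      𝟙 ⊕ 𝟘 ⊕ 𝟘                                    ≡⟨⟩
      𝟙                                            ∎
    where
    open ≋-mod-Reasoning (p ℕ.* s)
    ps∣ps : + (p ℕ.* s) ∣ + p * + s
    ps∣ps = divides 1ℤ (trans (sym (ℤ.pos-* p s)) (sym (ℤ.*-identityˡ _)))
    ps∣ss : + (p ℕ.* s) ∣ + s * + s
    ps∣ss = subst (+ (p ℕ.* s) ∣_) (ℤ.pos-* s s) (∣ᵤ⇒∣ (ℕ.*-monoˡ-∣ s p∣s))

  period-lift : ∀ {p k n} → Period (p ^ℕ suc k) n → Period (p ^ℕ suc (suc k)) (n ℕ.* p)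
  period-lift {p} {k} {n} (period Tⁿ≋𝟙) =
    period (subst (_≋ 𝟙 mod _) (^-assocʳ T n p) (≋𝟙⇒^≋𝟙 {p} (ℕ.m∣m*n (p ^ℕ k)) Tⁿ≋𝟙))

  period-lift-^ : ∀ {p t} → Period p t → ∀ b → Period (p ^ℕ suc b) (t ℕ.* p ^ℕ b)
  period-lift-^ {p} {t} Tᵗ≋𝟙 zero =
    subst₂ Period (sym (ℕ.*-identityʳ p)) (sym (ℕ.*-identityʳ t)) Tᵗ≋𝟙
  period-lift-^ {p} {t} Tᵗ≋𝟙 (suc b) =
    subst (Period _) t*pᵇ*p≡t*pᵇ⁺¹ (period-lift {p} {b} (period-lift-^ Tᵗ≋𝟙 b))
    where
    t*pᵇ*p≡t*pᵇ⁺¹ : t ℕ.* p ^ℕ b ℕ.* p ≡ t ℕ.* p ^ℕ suc b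
    t*pᵇ*p≡t*pᵇ⁺¹ = trans (ℕ.*-assoc t (p ^ℕ b) p) (cong (t ℕ.*_) (ℕ.*-comm (p ^ℕ b) p))

  T⊗mk : ∀ a b → T ⊗ mk a b ≡ mk b (a + κ * b)
  T⊗mk a b = cong₂ mk (solve (a ∷ b ∷ [])) (solve (κ ∷ a ∷ b ∷ []))

  T-cancel-mod : ∀ {M x y} → T ⊗ x ≋ T ⊗ y mod M → x ≋ y mod M
  T-cancel-mod {M} {x} {y} Tx≋Ty = begin
    x               ≡⟨ T⁻¹⊗T⊗ x ⟨
    T⁻¹ ⊗ (T ⊗ x)   ≈⟨ ⊗-cong-mod {x = T⁻¹} ≋-mod-refl Tx≋Ty ⟩
    T⁻¹ ⊗ (T ⊗ y)   ≡⟨ T⁻¹⊗T⊗ y ⟩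
    y               ∎
    where
    open ≋-mod-Reasoning M
    T⁻¹ = mk (- κ) 1ℤ
    T⁻¹⊗T⊗ : ∀ x → T⁻¹ ⊗ (T ⊗ x) ≡ x
    T⁻¹⊗T⊗ (mk a b) = cong₂ mk (solve (κ ∷ a ∷ b ∷ [])) (solve (κ ∷ a ∷ b ∷ []))

  D : ℤ
  D = κ * κ + + 4

  U : R
  U = mk (- κ) (+ 2)

  2T≡κ+U : ι (+ 2) ⊗ T ≡ ι κ ⊕ U
  2T≡κ+U = cong₂ mk (solve (κ ∷ [])) (solve (κ ∷ []))

  U²≡D : U ⊗ U ≡ ι D
  U²≡D = cong₂ mk κ²+4≡D (solve (κ ∷ []))
    where
    κ²+4≡D : (- κ) * (- κ) + + 2 * + 2 ≡ κ * κ + + 4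
    κ²+4≡D = solve (κ ∷ [])

  κ-U≡2[κ-T] : ι κ ⊕ ι -1ℤ ⊗ U ≡ ι (+ 2) ⊗ mk κ -1ℤ
  κ-U≡2[κ-T] = cong₂ mk (solve (κ ∷ [])) (solve (κ ∷ []))

  T⊗[κ-T]≡-1 : T ⊗ mk κ -1ℤ ≡ ι -1ℤ
  T⊗[κ-T]≡-1 = cong₂ mk (solve (κ ∷ [])) (solve (κ ∷ []))

  [κ+U]^-step : ∀ x c →
    (ι κ ⊕ U) ⊗ (ι x ⊗ (ι κ ⊕ ι c ⊗ U))
      ≡ ι (κ * x) ⊗ (ι κ ⊕ ι (1ℤ + c) ⊗ U) ⊕ ι (x * c) ⊗ (U ⊗ U)
  [κ+U]^-step x c = cong₂ mk (solve (κ ∷ x ∷ c ∷ [])) (solve (κ ∷ x ∷ c ∷ []))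

  ι-⊗-[κ+c·U] : ∀ x c → ι x ⊗ (ι κ ⊕ ι c ⊗ U) ≡ mk (x * (κ - c * κ)) (x * (+ 2 * c))
  ι-⊗-[κ+c·U] x c = cong₂ mk (solve (κ ∷ x ∷ c ∷ [])) (solve (κ ∷ x ∷ c ∷ []))

  module _ {q} (q-prime : Prime q) (q≢2 : q ≢ 2) (q∣D : + q ∣ D) where
    private
      q∤2 : ¬ + q ∣ + 2
      q∤2 = prime≢2⇒∤2 q-prime q≢2

    κ²≈-4 : κ * κ ≈ - + 4 mod q
    κ²≈-4 = begin
      κ * κ               ≡⟨ solve (κ ∷ []) ⟩
      κ * κ + + 4 - + 4   ≈⟨ +-cong-mod (∣⇒≈0-mod q∣D) (≈-mod-refl {a = - + 4}) ⟩
      - + 4               ∎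
      where open ≈-mod-Reasoning q

    q∤κ : ¬ + q ∣ κ
    q∤κ q∣κ = prime∤^ q-prime q∤2 2 (≈0-mod⇒∣ (begin
      + 4          ≡⟨ ℤ.neg-involutive (+ 4) ⟨
      - - + 4      ≈⟨ neg-cong-mod κ²≈-4 ⟨
      - (κ * κ)    ≈⟨ neg-cong-mod (*-cong-mod (∣⇒≈0-mod q∣κ) (∣⇒≈0-mod q∣κ)) ⟩
      0ℤ           ∎))
      where open ≈-mod-Reasoning q

    κ^≈2^ : ℕ → Set
    κ^≈2^ n = κ ^ℤ n ≈ (+ 2) ^ℤ n mod q

    κ^≈2^-* : ∀ k m → κ^≈2^ m → κ^≈2^ (k ℕ.* m)
    κ^≈2^-* k m κᵐ≈2ᵐ = begin
      κ ^ℤ (k ℕ.* m)          ≡⟨ ^-* κ ⟩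
      (κ ^ℤ m) ^ℤ k           ≈⟨ ^-cong-mod k κᵐ≈2ᵐ ⟩
      ((+ 2) ^ℤ m) ^ℤ k       ≡⟨ ^-* (+ 2) ⟨
      (+ 2) ^ℤ (k ℕ.* m)      ∎
      where
      open ≈-mod-Reasoning q
      ^-* : ∀ a → a ^ℤ (k ℕ.* m) ≡ (a ^ℤ m) ^ℤ k
      ^-* a = trans (cong (a ^ℤ_) (ℕ.*-comm k m)) (sym (ℤ.^-*-assoc a m k))

    κ^≈2^-∸ : ∀ a b → κ^≈2^ a → κ^≈2^ (a ℕ.+ b) → κ^≈2^ b
    κ^≈2^-∸ a b κᵃ≈2ᵃ κᵃ⁺ᵇ≈2ᵃ⁺ᵇ =
      *-cancelˡ-mod ((+ 2) ^ℤ a) q-prime (prime∤^ q-prime q∤2 a) (begin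
      (+ 2) ^ℤ a * κ ^ℤ b         ≈⟨ *-cong-mod κᵃ≈2ᵃ (≈-mod-refl {a = κ ^ℤ b}) ⟨
      κ ^ℤ a * κ ^ℤ b             ≡⟨ ℤ.^-distribˡ-+-* κ a b ⟨
      κ ^ℤ (a ℕ.+ b)              ≈⟨ κᵃ⁺ᵇ≈2ᵃ⁺ᵇ ⟩
      (+ 2) ^ℤ (a ℕ.+ b)          ≡⟨ ℤ.^-distribˡ-+-* (+ 2) a b ⟩
      (+ 2) ^ℤ a * (+ 2) ^ℤ b     ∎)
      where open ≈-mod-Reasoning q

    κ^≈2^-4 : κ^≈2^ 4
    κ^≈2^-4 = begin
      κ ^ℤ 4                     ≡⟨⟩
      κ * (κ * (κ * (κ * 1ℤ)))   ≡⟨ solve (κ ∷ []) ⟩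
      (κ * κ) * (κ * κ)          ≈⟨ *-cong-mod κ²≈-4 κ²≈-4 ⟩
      + 16                       ∎
      where open ≈-mod-Reasoning q

    ¬κ^≈2^-2 : ¬ κ^≈2^ 2
    ¬κ^≈2^-2 κ²≈4 = prime∤^ q-prime q∤2 3 (divides-difference (begin
      + 4            ≈⟨ κ²≈4 ⟨
      κ ^ℤ 2         ≡⟨ cong (κ *_) (ℤ.*-identityʳ κ) ⟩
      κ * κ          ≈⟨ κ²≈-4 ⟩
      - + 4          ∎))
      where open ≈-mod-Reasoning q

    κ^≈2^⇒4∣ : ∀ {n} → κ^≈2^ n → 4 ℕ.∣ n
    κ^≈2^⇒4∣ {n} κⁿ≈2ⁿ with ∣4⇒∣2⊎≡4 (gcd[m,n]∣n n 4)
    ... | inj₂ g≡4 = subst (ℕ._∣ n) g≡4 (gcd[m,n]∣m n 4)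
    ... | inj₁ (ℕ.divides k 2≡k*g) = contradiction (subst κ^≈2^ (sym 2≡k*g) (κ^≈2^-* k _ κᵍ≈2ᵍ)) ¬κ^≈2^-2
      where
      κᵍ≈2ᵍ : κ^≈2^ (gcd n 4)
      κᵍ≈2ᵍ = gcd-closed κ^≈2^ κ^≈2^-* κ^≈2^-∸ n 4 κⁿ≈2ⁿ κ^≈2^-4

    [κ+U]^≋ : ∀ n → (ι κ ⊕ U) ^ suc n ≋ ι (κ ^ℤ n) ⊗ (ι κ ⊕ ι (+ suc n) ⊗ U) mod q
    [κ+U]^≋ zero = ≋-mod-reflexive (cong₂ mk (solve (κ ∷ [])) (solve (κ ∷ [])))
    [κ+U]^≋ (suc n) = begin
      (ι κ ⊕ U) ⊗ (ι κ ⊕ U) ^ suc n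
        ≈⟨ ⊗-cong-mod (≋-mod-refl {x = ι κ ⊕ U}) ([κ+U]^≋ n) ⟩
      (ι κ ⊕ U) ⊗ (ι (κ ^ℤ n) ⊗ (ι κ ⊕ ι (+ suc n) ⊗ U))
        ≡⟨ [κ+U]^-step (κ ^ℤ n) (+ suc n) ⟩
      ι (κ ^ℤ suc n) ⊗ (ι κ ⊕ ι (1ℤ + + suc n) ⊗ U) ⊕ ι (κ ^ℤ n * + suc n) ⊗ (U ⊗ U)
        ≈⟨ ⊕-cong-mod {x = ι (κ ^ℤ suc n) ⊗ (ι κ ⊕ ι (1ℤ + + suc n) ⊗ U)} ≋-mod-refl
             (⊗-cong-mod {x = ι (κ ^ℤ n * + suc n)} ≋-mod-refl U⊗U≋𝟘) ⟩
      ι (κ ^ℤ suc n) ⊗ (ι κ ⊕ ι (1ℤ + + suc n) ⊗ U) ⊕ ι (κ ^ℤ n * + suc n) ⊗ 𝟘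
        ≡⟨ cong₂ _⊕_ (cong (λ c → ι (κ ^ℤ suc n) ⊗ (ι κ ⊕ ι c ⊗ U)) (sym (ℤ.pos-+ 1 (suc n))))
                     (⊗-zeroʳ (ι (κ ^ℤ n * + suc n))) ⟩
      ι (κ ^ℤ suc n) ⊗ (ι κ ⊕ ι (+ suc (suc n)) ⊗ U) ⊕ 𝟘
        ≡⟨ ⊕-identityʳ _ ⟩
      ι (κ ^ℤ suc n) ⊗ (ι κ ⊕ ι (+ suc (suc n)) ⊗ U)
        ∎
      where
      open ≋-mod-Reasoning q
      U⊗U≋𝟘 : U ⊗ U ≋ 𝟘 mod q
      U⊗U≋𝟘 = subst (_≋ 𝟘 mod q) (sym U²≡D) (ι-cong-mod (∣⇒≈0-mod q∣D))

    2ⁿ⁺¹Tⁿ⁺¹≋ : ∀ n → ι ((+ 2) ^ℤ suc n) ⊗ T ^ suc n ≋ ι (κ ^ℤ n) ⊗ (ι κ ⊕ ι (+ suc n) ⊗ U) mod q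
    2ⁿ⁺¹Tⁿ⁺¹≋ n = begin
      ι ((+ 2) ^ℤ suc n) ⊗ T ^ suc n          ≡⟨ cong (_⊗ T ^ suc n) (ι-^ (+ 2) (suc n)) ⟨
      ι (+ 2) ^ suc n ⊗ T ^ suc n             ≡⟨ ^-distrib-* (ι (+ 2)) T (suc n) ⟨
      (ι (+ 2) ⊗ T) ^ suc n                   ≡⟨ cong (_^ suc n) 2T≡κ+U ⟩
      (ι κ ⊕ U) ^ suc n                       ≈⟨ [κ+U]^≋ n ⟩
      ι (κ ^ℤ n) ⊗ (ι κ ⊕ ι (+ suc n) ⊗ U)    ∎
      where open ≋-mod-Reasoning q

    x[κ+cU]≋κx : ∀ x {c} → c ≈ 0ℤ mod q → ι x ⊗ (ι κ ⊕ ι c ⊗ U) ≋ ι (κ * x) mod q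
    x[κ+cU]≋κx x {c} c≈0 = begin
      ι x ⊗ (ι κ ⊕ ι c ⊗ U)   ≈⟨ ⊗-cong-mod {x = ι x} ≋-mod-refl
                                   (⊕-cong-mod {x = ι κ} ≋-mod-refl (⊗-cong-mod (ι-cong-mod c≈0) (≋-mod-refl {x = U}))) ⟩
      ι x ⊗ (ι κ ⊕ 𝟘 ⊗ U)     ≡⟨ cong₂ mk (solve (κ ∷ x ∷ [])) (solve (κ ∷ x ∷ [])) ⟩
      ι (κ * x)               ∎
      where open ≋-mod-Reasoning q

    period⇒∣∧κ^≈2^ : ∀ {n} → Period q (suc n) → q ℕ.∣ suc n × κ^≈2^ (suc n)
    period⇒∣∧κ^≈2^ {n} (period Tⁿ⁺¹≋𝟙) =
      ∣⇒∣ᵤ q∣1+n , ≈-mod-sym (c₀-≈ (≋-mod-trans 2ⁿ⁺¹≋ (x[κ+cU]≋κx x {c} (∣⇒≈0-mod q∣1+n))))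
      where
      x = κ ^ℤ n
      c = + suc n
      2ⁿ⁺¹≋ : ι ((+ 2) ^ℤ suc n) ≋ ι x ⊗ (ι κ ⊕ ι c ⊗ U) mod q
      2ⁿ⁺¹≋ = begin
        ι ((+ 2) ^ℤ suc n)                  ≡⟨ ⊗-identityʳ _ ⟨
        ι ((+ 2) ^ℤ suc n) ⊗ 𝟙              ≈⟨ ⊗-cong-mod {x = ι ((+ 2) ^ℤ suc n)} ≋-mod-refl Tⁿ⁺¹≋𝟙 ⟨
        ι ((+ 2) ^ℤ suc n) ⊗ T ^ suc n      ≈⟨ 2ⁿ⁺¹Tⁿ⁺¹≋ n ⟩
        ι x ⊗ (ι κ ⊕ ι c ⊗ U)               ∎
        where open ≋-mod-Reasoning q
      q∣x[2c] : + q ∣ x * (+ 2 * c)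
      q∣x[2c] = ≈0-mod⇒∣ (≈-mod-sym (c₁-≈ (≋-mod-trans 2ⁿ⁺¹≋ (≋-mod-reflexive (ι-⊗-[κ+c·U] x c)))))
      q∣1+n : + q ∣ c
      q∣1+n = prime∣*⇒∣ʳ (+ 2) q-prime q∤2 (prime∣*⇒∣ʳ x q-prime (prime∤^ q-prime q∤κ n) q∣x[2c])

    ∣∧κ^≈2^⇒period : ∀ {n} → q ℕ.∣ suc n → κ^≈2^ (suc n) → Period q (suc n)
    ∣∧κ^≈2^⇒period {n} q∣1+n κⁿ⁺¹≈2ⁿ⁺¹ =
      period (ι-⊗-cancel-mod ((+ 2) ^ℤ suc n) q-prime (prime∤^ q-prime q∤2 (suc n)) (begin
        ι ((+ 2) ^ℤ suc n) ⊗ T ^ suc n          ≈⟨ 2ⁿ⁺¹Tⁿ⁺¹≋ n ⟩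
        ι (κ ^ℤ n) ⊗ (ι κ ⊕ ι (+ suc n) ⊗ U)    ≈⟨ x[κ+cU]≋κx (κ ^ℤ n) {+ suc n} (∣⇒≈0-mod (∣ᵤ⇒∣ q∣1+n)) ⟩
        ι (κ ^ℤ suc n)                          ≈⟨ ι-cong-mod κⁿ⁺¹≈2ⁿ⁺¹ ⟩
        ι ((+ 2) ^ℤ suc n)                      ≡⟨ ⊗-identityʳ _ ⟨
        ι ((+ 2) ^ℤ suc n) ⊗ 𝟙                  ∎))
      where open ≋-mod-Reasoning q

    period⇒4∣ : ∀ {n} → Period q n → 4 ℕ.∣ n
    period⇒4∣ {zero}  _      = 4 ℕ.∣0
    period⇒4∣ {suc n} Tⁿ≋𝟙 = κ^≈2^⇒4∣ (proj₂ (period⇒∣∧κ^≈2^ Tⁿ≋𝟙))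

    period-4q : Period q (4 ℕ.* q)
    period-4q = subst (Period q) 1+pred[4q]≡4q
      (∣∧κ^≈2^⇒period (subst (q ℕ.∣_) (sym 1+pred[4q]≡4q) (ℕ.n∣m*n 4))
        (subst κ^≈2^ (trans (ℕ.*-comm q 4) (sym 1+pred[4q]≡4q)) (κ^≈2^-* q 4 κ^≈2^-4)))
      where
      instance _ = prime⇒nonZero q-prime
      1+pred[4q]≡4q : suc (ℕ.pred (4 ℕ.* q)) ≡ 4 ℕ.* q
      1+pred[4q]≡4q = ℕ.suc-pred (4 ℕ.* q) {{ℕ.m*n≢0 4 q}}

-- K-Fibonacci numbers

module KFibonacci (K : ℕ) where
  open import Data.Integer.Base using (_+_; _-_; _*_; -_) renaming (_^_ to _^ℤ_)
  open import Data.Integer.Divisibility.Signed using (_∣_; ∣n⇒∣m*n; ∣ᵤ⇒∣)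
  import Data.Nat.Divisibility as ℕ
  import Data.Nat.Base as ℕ
  import Data.Nat.Properties as ℕ
  open QuadraticRing (+ K) public

  F : ℕ → ℤ
  F n = + kFib K n

  -- F₋₁ n is F (n - 1), with F (-1) = 1.
  F₋₁ : ℕ → ℤ
  F₋₁ zero    = 1ℤ
  F₋₁ (suc n) = F n

  F-rec : ∀ n → F (suc n) ≡ F₋₁ n + + K * F n
  F-rec zero    = sym (cong (λ a → 1ℤ + a) (ℤ.*-zeroʳ (+ K)))
  F-rec (suc n) = trans (ℤ.pos-+ (K ℕ.* kFib K (suc n)) (kFib K n))
                        (trans (cong (_+ F n) (ℤ.pos-* K (kFib K (suc n)))) (ℤ.+-comm (+ K * F (suc n)) (F n)))

  T^≡ : ∀ n → T ^ n ≡ mk (F₋₁ n) (F n)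
  T^≡ zero    = refl
  T^≡ (suc n) = trans (cong (T ⊗_) (T^≡ n)) (trans (T⊗mk (F₋₁ n) (F n)) (cong (mk (F n)) (sym (F-rec n))))

  isPeriod⇒period : ∀ {m n} .{{_ : NonZero m}} → IsPeriod K m n → Period m n
  isPeriod⇒period {m} {n} (_ , F[i+n]%m≡F[i]%m) = period (subst (_≋ 𝟙 mod m) (sym (T^≡ n)) ⟨ F₋₁n≈1 , Fn≈0 ⟩)
    where
    Fn≈0 : F n ≈ 0ℤ mod m
    Fn≈0 = %≡%⇒≈-mod _ _ (F[i+n]%m≡F[i]%m 0)
    F₋₁n≈1 : F₋₁ n ≈ 1ℤ mod m
    F₋₁n≈1 = begin
      F₋₁ n                ≈⟨ +-∣-≈-mod (F₋₁ n) (∣n⇒∣m*n (+ K) (≈0-mod⇒∣ Fn≈0)) ⟨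
      F₋₁ n + + K * F n    ≡⟨ F-rec n ⟨
      F (suc n)            ≈⟨ %≡%⇒≈-mod _ _ (F[i+n]%m≡F[i]%m 1) ⟩
      1ℤ                   ∎
      where open ≈-mod-Reasoning m

  period⇒isPeriod : ∀ {m n} .{{_ : NonZero m}} → 1 ℕ.≤ n → Period m n → IsPeriod K m n
  period⇒isPeriod {m} {n} 1≤n (period Tⁿ≋𝟙) = 1≤n , λ i → ≈-mod⇒%≡% _ _ (c₁-≈ (begin
    mk (F₋₁ (i ℕ.+ n)) (F (i ℕ.+ n))   ≡⟨ T^≡ (i ℕ.+ n) ⟨
    T ^ (i ℕ.+ n)                      ≡⟨ ^-homo-* T i n ⟩
    T ^ i ⊗ T ^ n                      ≈⟨ ⊗-cong-mod {x = T ^ i} ≋-mod-refl Tⁿ≋𝟙 ⟩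
    T ^ i ⊗ 𝟙                          ≡⟨ ⊗-identityʳ (T ^ i) ⟩
    T ^ i                              ≡⟨ T^≡ i ⟩
    mk (F₋₁ i) (F i)                   ∎))
    where open ≋-mod-Reasoning m

  even⇒period-2 : 2 ℕ.∣ K → Period 2 2
  even⇒period-2 2∣K = period (subst (_≋ 𝟙 mod 2) (sym (T^≡ 2)) ⟨ ≈-mod-refl , ∣⇒≈0-mod (∣ᵤ⇒∣ 2∣F2) ⟩)
    where
    2∣F2 : 2 ℕ.∣ kFib K 2
    2∣F2 = subst (2 ℕ.∣_) (sym (trans (ℕ.+-identityʳ _) (ℕ.*-identityʳ K))) 2∣K

  D≡K²+4 : D ≡ + (K ℕ.* K ℕ.+ 4)
  D≡K²+4 = sym (trans (ℤ.pos-+ (K ℕ.* K) 4) (cong (_+ + 4) (ℤ.pos-* K K)))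

  period-∤D : ∀ {p} → Prime p → p ≢ 2 → ¬ (+ p ∣ D) → Period p (p ℕ.∸ 1) ⊎ Period p (suc p ℕ.* 2)
  period-∤D {p} p-prime p≢2 p∤D with h , refl ← odd-prime⇒≡1+2h p-prime p≢2 =
    Sum.map e≈1⇒period e≈-1⇒period (square≈1⇒≈±1 e p-prime e²≈1)
    where
    p∤2 : ¬ (+ p ∣ + 2)
    p∤2 = prime≢2⇒∤2 p-prime p≢2

    e = D ^ℤ h

    Uᵖ≡eU : U ^ p ≡ ι e ⊗ U
    Uᵖ≡eU = begin
      U ⊗ U ^ (2 ℕ.* h)    ≡⟨ cong (U ⊗_) (^-assocʳ U 2 h) ⟨
      U ⊗ (U ^ 2) ^ h      ≡⟨ cong (λ x → U ⊗ x ^ h) (trans (cong (U ⊗_) (⊗-identityʳ U)) U²≡D) ⟩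
      U ⊗ ι D ^ h          ≡⟨ cong (U ⊗_) (ι-^ D h) ⟩
      U ⊗ ι e              ≡⟨ ⊗-comm U (ι e) ⟩
      ι e ⊗ U              ∎
      where open ≡-Reasoning

    2Tᵖ≋κ+eU : ι (+ 2) ⊗ T ^ p ≋ ι (+ K) ⊕ ι e ⊗ U mod p
    2Tᵖ≋κ+eU = begin
      ι (+ 2) ⊗ T ^ p             ≈⟨ ⊗-cong-mod (ι-cong-mod (fermat p-prime 2)) (≋-mod-refl {x = T ^ p}) ⟨
      ι ((+ 2) ^ℤ p) ⊗ T ^ p      ≡⟨ cong (_⊗ T ^ p) (ι-^ (+ 2) p) ⟨
      ι (+ 2) ^ p ⊗ T ^ p         ≡⟨ ^-distrib-* (ι (+ 2)) T p ⟨
      (ι (+ 2) ⊗ T) ^ p           ≡⟨ cong (_^ p) 2T≡κ+U ⟩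
      (ι (+ K) ⊕ U) ^ p           ≈⟨ frobenius-mod p-prime (ι (+ K)) U ⟩
      ι (+ K) ^ p ⊕ U ^ p         ≡⟨ cong₂ _⊕_ (ι-^ (+ K) p) Uᵖ≡eU ⟩
      ι ((+ K) ^ℤ p) ⊕ ι e ⊗ U    ≈⟨ ⊕-cong-mod (ι-cong-mod (fermat p-prime K)) (≋-mod-refl {x = ι e ⊗ U}) ⟩
      ι (+ K) ⊕ ι e ⊗ U           ∎
      where open ≋-mod-Reasoning p

    e²≈1 : e * e ≈ 1ℤ mod p
    e²≈1 = *-cancelˡ-mod D p-prime p∤D (begin
      D * (e * e)                  ≡⟨ cong (D *_) (ℤ.^-distribˡ-+-* D h h) ⟨
      D ^ℤ suc (h ℕ.+ h)           ≡⟨ cong (λ k → D ^ℤ suc (h ℕ.+ k)) (ℕ.+-identityʳ h) ⟨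
      D ^ℤ p                       ≡⟨ cong (_^ℤ p) D≡K²+4 ⟩
      (+ (K ℕ.* K ℕ.+ 4)) ^ℤ p     ≈⟨ fermat p-prime (K ℕ.* K ℕ.+ 4) ⟩
      + (K ℕ.* K ℕ.+ 4)            ≡⟨ D≡K²+4 ⟨
      D                            ≡⟨ ℤ.*-identityʳ D ⟨
      D * 1ℤ                       ∎)
      where open ≈-mod-Reasoning p

    e≈1⇒period : e ≈ 1ℤ mod p → Period p (2 ℕ.* h)
    e≈1⇒period e≈1 = period (T-cancel-mod (ι-⊗-cancel-mod (+ 2) p-prime p∤2 (begin
      ι (+ 2) ⊗ (T ⊗ T ^ (2 ℕ.* h))   ≈⟨ 2Tᵖ≋κ+eU ⟩
      ι (+ K) ⊕ ι e ⊗ U               ≈⟨ ⊕-cong-mod {x = ι (+ K)} ≋-mod-refl (⊗-cong-mod (ι-cong-mod e≈1) (≋-mod-refl {x = U})) ⟩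
      ι (+ K) ⊕ 𝟙 ⊗ U                 ≡⟨ cong (ι (+ K) ⊕_) (⊗-identityˡ U) ⟩
      ι (+ K) ⊕ U                     ≡⟨ 2T≡κ+U ⟨
      ι (+ 2) ⊗ T                     ≡⟨ cong (ι (+ 2) ⊗_) (⊗-identityʳ T) ⟨
      ι (+ 2) ⊗ (T ⊗ 𝟙)               ∎)))
      where open ≋-mod-Reasoning p

    e≈-1⇒period : e ≈ -1ℤ mod p → Period p (suc p ℕ.* 2)
    e≈-1⇒period e≈-1 = period (begin
      T ^ (suc p ℕ.* 2)     ≡⟨ ^-assocʳ T (suc p) 2 ⟨
      (T ⊗ T ^ p) ^ 2       ≈⟨ ^-congˡ-mod 2 (⊗-cong-mod {x = T} ≋-mod-refl Tᵖ≋κ-T) ⟩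
      (T ⊗ mk (+ K) -1ℤ) ^ 2 ≡⟨ cong (_^ 2) T⊗[κ-T]≡-1 ⟩
      ι -1ℤ ^ 2             ≡⟨ ι-^ -1ℤ 2 ⟩
      𝟙                     ∎)
      where
      open ≋-mod-Reasoning p
      Tᵖ≋κ-T : T ^ p ≋ mk (+ K) -1ℤ mod p
      Tᵖ≋κ-T = ι-⊗-cancel-mod (+ 2) p-prime p∤2 (begin
        ι (+ 2) ⊗ T ^ p          ≈⟨ 2Tᵖ≋κ+eU ⟩
        ι (+ K) ⊕ ι e ⊗ U        ≈⟨ ⊕-cong-mod {x = ι (+ K)} ≋-mod-refl (⊗-cong-mod (ι-cong-mod e≈-1) (≋-mod-refl {x = U})) ⟩
        ι (+ K) ⊕ ι -1ℤ ⊗ U      ≡⟨ κ-U≡2[κ-T] ⟩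
        ι (+ 2) ⊗ mk (+ K) -1ℤ   ∎)

-- Factorisations over a given list of primes

module _ where
  open import Data.Nat.Base
  open import Data.Nat.Properties
  open import Data.Nat.Divisibility
  open import Data.List.Base using (map; length)
  open import Data.List.Relation.Unary.All using (All; []; _∷_)
  open import Data.List.Relation.Unary.Any using (here; there)
  open import Data.List.Membership.Propositional using (_∈_)
  open import Data.Nat.DivMod using (_/_; m≡m%n+[m/n]*n)

  prime∣factorValue⇒∈ : ∀ {q} → Prime q → ∀ {fs} → All (Prime ∘ proj₁) fs → q ∣ factorValue fs → q ∈ map proj₁ fs
  prime∣factorValue⇒∈ q-prime {[]} [] q∣1 = contradiction (∣1⇒≡1 q∣1) (>⇒≢ (prime>1 q-prime))
  prime∣factorValue⇒∈ q-prime {(p , a) ∷ fs} (p-prime ∷ fs-prime) q∣pᵃΠ with euclidsLemma _ _ q-prime q∣pᵃΠ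
  ... | inj₁ q∣pᵃ = here (prime∣prime⇒≡ q-prime p-prime (prime∣^⇒∣ q-prime a q∣pᵃ))
  ... | inj₂ q∣Π  = there (prime∣factorValue⇒∈ q-prime fs-prime q∣Π)

  primePow-complete : ∀ {ps} → All Prime ps → ∀ n → .{{NonZero n}} → (∀ {q} → Prime q → q ∣ n → q ∈ ps) →
                      ∃[ js ] length js ≡ length ps × n ≡ primePow ps js
  primePow-complete [] 1 _ = [] , refl , refl
  primePow-complete [] (suc (suc n)) prime-divisors-in-[] with _ , q-prime , q∣n ← prime-divisor (s<s (s<s z≤n))
    with () ← prime-divisors-in-[] q-prime q∣n
  primePow-complete {p ∷ ps} (p-prime ∷ ps-prime) n prime-divisors-in-p∷ps
    with j , n′ , n≡pʲn′ , p∤n′ ← valuation (prime>1 p-prime) n =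
    let js , |js|≡|ps| , n′≡Πps^js = primePow-complete ps-prime n′ {{n′≢0}} prime-divisors-in-ps
    in j ∷ js , cong suc |js|≡|ps| , trans n≡pʲn′ (cong (p ^ j *_) n′≡Πps^js)
    where
    n′≢0 : NonZero n′
    n′≢0 = m*n≢0⇒n≢0 (p ^ j) {{subst NonZero n≡pʲn′ (>-nonZero (>-nonZero⁻¹ n))}}
    prime-divisors-in-ps : ∀ {q} → Prime q → q ∣ n′ → q ∈ ps
    prime-divisors-in-ps q-prime q∣n′ with prime-divisors-in-p∷ps q-prime (∣-trans q∣n′ (divides (p ^ j) n≡pʲn′))
    ... | here refl = contradiction q∣n′ p∤n′
    ... | there q∈ps = q∈ps

  %4≡2⇒2∣ : ∀ {n} → n % 4 ≡ 2 → 2 ∣ n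
  %4≡2⇒2∣ {n} n%4≡2 = subst (2 ∣_) (sym (m≡m%n+[m/n]*n n 4))
    (∣m∣n⇒∣m+n (subst (2 ∣_) (sym n%4≡2) ∣-refl) (∣-trans (divides 2 refl) (n∣m*n (n / 4))))

-- Fixed points of the Pisano period

module FixedPoint (K m : ℕ) .{{_ : NonZero m}} (π[m]≡m : PisanoIs K m m) where
  open import Data.Nat.Base
  open import Data.Nat.Properties
  open import Data.Nat.Divisibility
  open import Data.Nat.Coprimality using (Coprime; coprime-divisor; prime⇒coprime) renaming (sym to ⊥-sym)
  open import Data.Integer.Divisibility.Signed using (∣⇒∣ᵤ) renaming (_∣_ to _∣ℤ_; _∣?_ to _∣ℤ?_)
  open import Relation.Nullary.Decidable using (decidable-stable)
  open import Data.List.Base using (map; length)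
  open import Data.List.Properties using (length-map)
  open import Data.List.Relation.Unary.All as All using (All)
  import Data.List.Relation.Unary.All.Properties as All
  open import Data.List.Relation.Unary.Any using (here)
  open import Data.List.Membership.Propositional using (_∈_)
  open KFibonacci K hiding (_^_)

  period-m : Period m m
  period-m = isPeriod⇒period (proj₁ π[m]≡m)

  m-minimal : ∀ {n} → 0 < n → Period m n → m ≤ n
  m-minimal 0<n Tⁿ≋𝟙 = proj₂ π[m]≡m _ (period⇒isPeriod 0<n Tⁿ≋𝟙)

  prime∣D∧∣m⇒4∣m : ∀ {q} → Prime q → q ≢ 2 → + q ∣ℤ D → q ∣ m → 4 ∣ m
  prime∣D∧∣m⇒4∣m q-prime q≢2 q∣D q∣m = period⇒4∣ q-prime q≢2 q∣D (period-mod-∣ q∣m period-m)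

  Exceptional : ℕ → Set
  Exceptional p = Prime p × p ≢ 2 × p ∣ m × ¬ (+ p ∣ℤ D)

  module _ (2∣K : 2 ∣ K) {p} (p-prime : Prime p) (p≢2 : p ≢ 2) (p∣m : p ∣ m) (p∤D : ¬ (+ p ∣ℤ D))
           (p-largest : ∀ {r} → Exceptional r → r ≤ p) where
    private
      N = quotient p∣m
      m≡Np : m ≡ N * p
      m≡Np = m∣n⇒n≡quotient*m p∣m
      2⊥p : Coprime 2 p
      2⊥p = ⊥-sym (prime∤⇒coprime p-prime (λ p∣2 → p≢2 (prime∣prime⇒≡ p-prime prime[2] p∣2)))

    private
      period-N*p : ∀ r e → r ^ suc e ∣ m → Period (r ^ suc e) (N * p)
      period-N*p _ _ rᵉ⁺¹∣m = subst (Period _) m≡Np (period-mod-∣ rᵉ⁺¹∣m period-m)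

      rᵉ∣N : ∀ {r} e → Prime r → r ^ suc e ∣ m → r ^ e ∣ N
      rᵉ∣N {r} e r-prime rᵉ⁺¹∣m with r ≟ p
      ... | yes refl = *-cancelˡ-∣ p {{prime⇒nonZero p-prime}} (subst (_ ∣_) (trans m≡Np (*-comm N p)) rᵉ⁺¹∣m)
      ... | no  r≢p  = ∣-trans (n∣m*n r) (coprime-divisor rᵉ⁺¹⊥p (subst (_ ∣_) (trans m≡Np (*-comm N p)) rᵉ⁺¹∣m))
        where
        rᵉ⁺¹⊥p : Coprime (r ^ suc e) p
        rᵉ⁺¹⊥p = coprime-^ˡ (prime∤⇒coprime r-prime (r≢p ∘ prime∣prime⇒≡ r-prime p-prime)) (suc e)

    period-N-mod-2^ : ∀ e → 2 ^ suc e ∣ m → Period (2 ^ suc e) N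
    period-N-mod-2^ e 2ᵉ⁺¹∣m =
      period-coprime-cancel (⊥-sym (coprime-^ˡ 2⊥p (suc e))) (period-N*p 2 e 2ᵉ⁺¹∣m)
        (period-∣ (n∣m*n N) (period-lift-^ (even⇒period-2 2∣K) e))

    period-N-mod-∣D : ∀ {r} e → Prime r → r ≢ 2 → + r ∣ℤ D → r ^ suc e ∣ m → Period (r ^ suc e) N
    period-N-mod-∣D {r} e r-prime r≢2 r∣D rᵉ⁺¹∣m =
      period-coprime-cancel (⊥-sym 4rrᵉ⊥p) (period-N*p r e rᵉ⁺¹∣m)
        (period-∣ (n∣m*n N) (period-lift-^ (period-4q r-prime r≢2 r∣D) e))
      where
      r⊥p : Coprime r p
      r⊥p = prime∤⇒coprime r-prime λ r∣p → p∤D (subst (λ x → + x ∣ℤ D) (prime∣prime⇒≡ r-prime p-prime r∣p) r∣D)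
      4rrᵉ⊥p : Coprime (4 * r * r ^ e) p
      4rrᵉ⊥p = coprime-*ˡ (coprime-*ˡ (coprime-^ˡ 2⊥p 2) r⊥p) (coprime-^ˡ r⊥p e)

    period-N-mod-∤D : ∀ {r} e → Prime r → r ≢ 2 → ¬ (+ r ∣ℤ D) → r ^ suc e ∣ m → Period (r ^ suc e) N
    period-N-mod-∤D {r} e r-prime r≢2 r∤D rᵉ⁺¹∣m with h , refl ← odd-prime⇒≡1+2h r-prime r≢2 =
      [ (λ Tʳ⁻¹≋𝟙 → cancel 2h⊥p (period-lift-^ Tʳ⁻¹≋𝟙 e))
      , (λ T²⁽ʳ⁺¹⁾≋𝟙 → cancel 2[r+1]⊥p (period-lift-^ T²⁽ʳ⁺¹⁾≋𝟙 e))
      ]′ (period-∤D r-prime r≢2 r∤D)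
      where
      cancel : ∀ {t} → Coprime t p → Period (r ^ suc e) (t * r ^ e) → Period (r ^ suc e) N
      cancel {t} t⊥p Tᵗʳᵉ≋𝟙 = period-coprime-cancel (⊥-sym t⊥p) (period-N*p r e rᵉ⁺¹∣m) (period-∣ t*rᵉ∣N*t Tᵗʳᵉ≋𝟙)
        where
        t*rᵉ∣N*t : t * r ^ e ∣ N * t
        t*rᵉ∣N*t = subst (t * r ^ e ∣_) (*-comm t N) (*-monoʳ-∣ t (rᵉ∣N e r-prime rᵉ⁺¹∣m))
      r≤p : r ≤ p
      r≤p = p-largest (r-prime , r≢2 , ∣-trans (m∣m*n (r ^ e)) rᵉ⁺¹∣m , r∤D)
      0<h : 0 < h
      0<h = n≢0⇒n>0 λ h≡0 → ¬prime[1] (subst (λ x → Prime (suc (2 * x))) h≡0 r-prime)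
      1+h<p : suc h < p
      1+h<p = <-≤-trans (s<s (m<m+n h (subst (0 <_) (sym (+-identityʳ h)) 0<h))) r≤p
      2h⊥p : Coprime (2 * h) p
      2h⊥p = coprime-*ˡ 2⊥p (⊥-sym (prime⇒coprime p-prime {{>-nonZero 0<h}} (<-trans (n<1+n h) 1+h<p)))
      2[r+1]⊥p : Coprime (suc r * 2) p
      2[r+1]⊥p = subst (λ x → Coprime (x * 2) p) [1+h]*2≡1+r
        (coprime-*ˡ (coprime-*ˡ (⊥-sym (prime⇒coprime p-prime 1+h<p)) 2⊥p) 2⊥p)
        where
        [1+h]*2≡1+r : suc h * 2 ≡ suc r
        [1+h]*2≡1+r = trans (*-comm (suc h) 2) (cong suc (+-suc h (h + 0)))

    period-N-mod-prime-power : ∀ r e → Prime r → r ^ suc e ∣ m → Period (r ^ suc e) N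
    period-N-mod-prime-power r e r-prime with r ≟ 2 | + r ∣ℤ? D
    ... | yes refl | _         = period-N-mod-2^ e
    ... | no  r≢2  | yes r∣D  = period-N-mod-∣D e r-prime r≢2 r∣D
    ... | no  r≢2  | no  r∤D  = period-N-mod-∤D e r-prime r≢2 r∤D

    largest-exceptional-absurd : ⊥
    largest-exceptional-absurd = <⇒≱ N<m (m-minimal 0<N (period-from-prime-powers m period-N-mod-prime-power))
      where
      instance _ = prime⇒nonZero p-prime
      0<N : 0 < N
      0<N = >-nonZero⁻¹ N {{m*n≢0⇒m≢0 N {{subst NonZero m≡Np (>-nonZero (>-nonZero⁻¹ m))}}}}
      N<m : N < m
      N<m = subst (N <_) (sym m≡Np) (m<m*n N p {{>-nonZero 0<N}} (prime>1 p-prime))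

  no-exceptional : 2 ∣ K → ∀ {p} → Exceptional p → ⊥
  no-exceptional 2∣K {p} = go p (<-wellFounded (m ∸ p))
    where
    go : ∀ p → Acc _<_ (m ∸ p) → Exceptional p → ⊥
    go p (acc rec) (p-prime , p≢2 , p∣m , p∤D) =
      largest-exceptional-absurd 2∣K p-prime p≢2 p∣m p∤D λ r-exceptional@(_ , _ , r∣m , _) →
        ≮⇒≥ λ p<r → go _ (rec (∸-monoʳ-< p<r (∣⇒≤ r∣m))) r-exceptional

  odd-prime∣m⇒∣D : 2 ∣ K → ∀ {q} → Prime q → q ≢ 2 → q ∣ m → + q ∣ℤ D
  odd-prime∣m⇒∣D 2∣K {q} q-prime q≢2 q∣m =
    decidable-stable (+ q ∣ℤ? D) λ q∤D → no-exceptional 2∣K (q-prime , q≢2 , q∣m , q∤D)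

  prime-divisor-of-m : 2 ∣ K → ∀ {q} → Prime q → q ∣ m → q ≡ 2 ⊎ + q ∣ℤ D
  prime-divisor-of-m 2∣K {q} q-prime q∣m with q ≟ 2
  ... | yes q≡2 = inj₁ q≡2
  ... | no  q≢2 = inj₂ (odd-prime∣m⇒∣D 2∣K q-prime q≢2 q∣m)

  power-of-2⊎4∣m : 2 ∣ K → 1 < m → (∃[ j ] m ≡ 2 ^ (j + 1)) ⊎ 4 ∣ m
  power-of-2⊎4∣m 2∣K 1<m with e , m′ , m≡2ᵉm′ , 2∤m′ ← valuation (s≤s (s≤s z≤n)) m = split e m′ m≡2ᵉm′ 2∤m′
    where
    split : ∀ e m′ → m ≡ 2 ^ e * m′ → ¬ 2 ∣ m′ → (∃[ j ] m ≡ 2 ^ (j + 1)) ⊎ 4 ∣ m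
    split e       0             m≡0     _    = contradiction (trans m≡0 (*-zeroʳ (2 ^ e))) (≢-nonZero⁻¹ m)
    split 0       1             m≡1     _    = contradiction m≡1 (>⇒≢ 1<m)
    split (suc j) 1             m≡2ʲ⁺¹  _    = inj₁ (j , trans m≡2ʲ⁺¹ (trans (*-identityʳ _) (cong (2 ^_) (+-comm 1 j))))
    split e       m′@(2+ _)     m≡2ᵉm′  2∤m′ with q , q-prime , q∣m′ ← prime-divisor {m′} (s≤s (s≤s z≤n)) =
      inj₂ (prime∣D∧∣m⇒4∣m q-prime q≢2 (odd-prime∣m⇒∣D 2∣K q-prime q≢2 q∣m) q∣m)
      where
      q≢2 : q ≢ 2
      q≢2 q≡2 = 2∤m′ (subst (_∣ m′) q≡2 q∣m′)
      q∣m : q ∣ m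
      q∣m = ∣-trans q∣m′ (divides (2 ^ e) m≡2ᵉm′)

  4∣m⇒factorisation : 2 ∣ K → ∀ {a fs} → All (Prime ∘ proj₁) ((2 , a) ∷ fs) → factorValue ((2 , a) ∷ fs) ≡ K * K + 4 →
    4 ∣ m → ∃[ j ] ∃[ js ] length js ≡ length fs × m ≡ 2 ^ (j + 2) * primePow (map proj₁ fs) js
  4∣m⇒factorisation 2∣K {a} {fs} fs-prime Πfs≡K²+4 4∣m
    with primePow-complete (All.map⁺ fs-prime) (quotient 4∣m) {{m″≢0}} prime-divisors-in-2∷fs
    where
    m″≢0 : NonZero (quotient 4∣m)
    m″≢0 = quotient≢0 4∣m {{>-nonZero (>-nonZero⁻¹ m)}}
    prime-divisors-in-2∷fs : ∀ {q} → Prime q → q ∣ quotient 4∣m → q ∈ map proj₁ ((2 , a) ∷ fs)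
    prime-divisors-in-2∷fs {q} q-prime q∣m″ with prime-divisor-of-m 2∣K q-prime (∣-trans q∣m″ (quotient-∣ 4∣m))
    ... | inj₁ refl = here refl
    ... | inj₂ q∣D  = prime∣factorValue⇒∈ q-prime fs-prime
                        (subst (q ∣_) (sym Πfs≡K²+4) (∣⇒∣ᵤ (subst (+ q ∣ℤ_) D≡K²+4 q∣D)))
  ... | [] , () , _
  ... | j ∷ js , |js|+1≡ , m″≡2ʲΠ = j , js , trans (suc-injective |js|+1≡) (length-map proj₁ fs) , (begin
    m                                    ≡⟨ m∣n⇒n≡quotient*m 4∣m ⟩
    quotient 4∣m * 4                     ≡⟨ cong (_* 4) m″≡2ʲΠ ⟩
    2 ^ j * Π * 4                        ≡⟨ *-assoc (2 ^ j) Π 4 ⟩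
    2 ^ j * (Π * 4)                      ≡⟨ cong (2 ^ j *_) (*-comm Π 4) ⟩
    2 ^ j * (4 * Π)                      ≡⟨ *-assoc (2 ^ j) 4 Π ⟨
    2 ^ j * 4 * Π                        ≡⟨ cong (_* Π) (^-distribˡ-+-* 2 j 2) ⟨
    2 ^ (j + 2) * Π                      ∎)
    where
    open ≡-Reasoning
    Π = primePow (map proj₁ fs) js

open import Data.Nat using (ℕ; suc; _+_; _*_; _^_; _≤_; _<_; _%_; NonZero)
open import Data.Product using (_×_; _,_; Σ; ∃-syntax)
open import Data.Sum using (_⊎_)
open import Data.List using (List; _∷_; length; map)
open import Data.Product using (proj₁)
open import Relation.Binary.PropositionalEquality using (_≡_)
import Data.List.Relation.Unary.All as All

theorem3p4 : (K : ℕ) → 1 ≤ K → K % 4 ≡ 2 →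
    (a₁ : ℕ) (rest : List (ℕ × ℕ)) →
    IsPrimeFactorization (K * K + 4) ((2 , a₁) ∷ rest) →
    (m : ℕ) .{{_ : NonZero m}} → 1 < m → PisanoIs K m m →
    (∃[ j₁ ] m ≡ 2 ^ (j₁ + 1))
    ⊎ (∃[ j₁ ] Σ (List ℕ) (λ js → (length js ≡ length rest)
         × (m ≡ 2 ^ (j₁ + 2) * primePow (map proj₁ rest) js)))
theorem3p4 K _ K%4≡2 a₁ rest (fs-prime , _ , Πfs≡K²+4) m 1<m π[m]≡m =
  Sum.map₂ (4∣m⇒factorisation 2∣K (All.map proj₁ fs-prime) Πfs≡K²+4) (power-of-2⊎4∣m 2∣K 1<m)
  where
  open FixedPoint K m π[m]≡m
  2∣K = %4≡2⇒2∣ K%4≡2
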